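{- Let $p$ be a prime number. Then $$Cl_2(M_2(\mathbb{Z}_p)) \cong \begin{cases} Shu^4_6(3K_2), & \text{if } p = 2,\\ Shu^{p^2+p+2}_{p^4-p^3-p^2+p}\left(\tfrac{p(p+1)}{2} K_2\right), & \text{if } p > 2.\end{cases}$$
   Context: $M_2(\mathbb{Z}_p)$ is the ring of $2\times 2$ matrices over $\mathbb{Z}_p$. For a ring $R$ with identity, $Id(R)$ denotes the set of idempotents and $U(R)$ the set of units of $R$. The clean graph $Cl(R)$ has vertex set $Id(R) \times U(R)$, and two distinct vertices $(e,u)$ and $(f,v)$ are adjacent if and only if $ef=fe=0$ or $uv=vu=1$. $Cl_2(R)$ is the induced subgraph of $Cl(R)$ on $\{(e,u): e \in Id(R)\setminus\{0\},\ u \in U(R)\}$. $K_2$ is the complete graph on two vertices and $aK_2$ is the disjoint union of $a$ copies of it. Shuriken graph: let $G$ be a graph and $n,t$ positive integers with $n-t$ even. Add a new vertex $z$ to $G$ (with no new edges) and take $n$ copies of the resulting graph, the $i$-th copy $G'_i$ having vertices $z_i$ and $v_i$ for $v \in V(G)$. The $(t,n)$-shuriken graph $Shu^t_n(G)$ has vertex set $\bigcup_{i=1}^n \{z_i, v_i : v \in V(G)\}$ and edge set consisting of: all $u_iv_j$ with $uv \in E(G)$ and $i,j \in \{1,\dots,n\}$; all $u_iv_i$ with $u_i \neq v_i$ both in $V(G'_i)$ for $i \in \{1,\dots,t\}$; and all $u_iv_{n+t+1-i}$ with $u_i \in V(G'_i)$, $v_{n+t+1-i} \in V(G'_{n+t+1-i})$,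 for $i \in \{t+1, \dots, \frac{n+t}{2}\}$. $\cong$ denotes graph isomorphism. -}

module Defs where

open import Level using (0ℓ)
open import Data.Nat using (ℕ; zero; suc; _+_; _*_; _≤_; NonZero)
import Data.Nat as ℕ
open import Data.Nat.DivMod using (_mod_)
open import Data.Nat.Primality using (Prime; prime⇒nonZero)
open import Data.Fin using (Fin; toℕ)
import Data.Fin as F
import Data.Fin.Properties as FP
open import Data.Bool using (Bool)
open import Data.Maybe using (Maybe; just; nothing)
open import Data.Product using (Σ; ∃; _×_; _,_; proj₁)
open import Data.Sum using (_⊎_)
open import Relation.Nullary using (¬_; Dec; yes; no)
open import Relation.Nullary.Decidable using (True; False; map′; _×-dec_)
open import Relation.Binary.PropositionalEquality using (_≡_; _≢_; refl; cong)
open import Relation.Binary.Definitions using (DecidableEquality)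
open import Function.Bundles using (_⤖_; Bijection; _⇔_)

record Graph : Set₁ where
  field
    Vertex : Set
    _~_    : Vertex → Vertex → Set

open Graph public

record _≅_ (G H : Graph) : Set where
  field
    bij  : Vertex G ⤖ Vertex H
    adj  : ∀ x y → (_~_ G x y ⇔ _~_ H (Bijection.to bij x) (Bijection.to bij y))

_K₂ : ℕ → Graph
a K₂ = record
  { Vertex = Fin a × Bool
  ; _~_    = λ { (i , b) (j , c) → i ≡ j × b ≢ c } }

-- Shuriken graph Shu^t_n(G)  (copies indexed 1..n, written as Fin n with
-- copy number  suc (toℕ i) ; the new vertex z is  nothing, v ∈ V(G) is  just v)

data ShuEdge (t n : ℕ) (G : Graph) : Fin n × Maybe (Vertex G) → Fin n × Maybe (Vertex G) → Set where
  base  : ∀ i j u v → _~_ G u v → ShuEdge t n G (i , just u) (j , just v)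
  full  : ∀ i x y → suc (toℕ i) ≤ t → (i , x) ≢ (i , y) → ShuEdge t n G (i , x) (i , y)
  cross : ∀ i j x y → t + 1 ≤ suc (toℕ i) → suc (toℕ i) ≤ ℕ._/_ (n + t) 2
          → suc (toℕ j) ≡ ℕ._∸_ (n + t + 1) (suc (toℕ i)) → ShuEdge t n G (i , x) (j , y)

Shu : (t n : ℕ) → Graph → Graph
Shu t n G = record
  { Vertex = Fin n × Maybe (Vertex G)
  ; _~_    = λ x y → ShuEdge t n G x y ⊎ ShuEdge t n G y x }

module Zmod (m : ℕ) .{{_ : NonZero m}} where

  Zm : Set
  Zm = Fin m

  infixl 6 _+ₘ_
  infixl 7 _*ₘ_ _·_
  infix 4 _≟M_

  _+ₘ_ _*ₘ_ : Zm → Zm → Zm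
  x +ₘ y = (toℕ x + toℕ y) mod m
  x *ₘ y = (toℕ x * toℕ y) mod m

  0ₘ 1ₘ : Zm
  0ₘ = 0 mod m
  1ₘ = 1 mod m

  record Mat : Set where
    constructor mat
    field a b c d : Zm

  _≟M_ : DecidableEquality Mat
  mat a b c d ≟M mat a' b' c' d' =
    map′ (λ { (refl , refl , refl , refl) → refl })
         (λ { refl → refl , refl , refl , refl })
         ((a F.≟ a') ×-dec ((b F.≟ b') ×-dec ((c F.≟ c') ×-dec (d F.≟ d'))))

  _·_ : Mat → Mat → Mat
  mat a b c d · mat a' b' c' d' =
    mat ((a *ₘ a') +ₘ (b *ₘ c')) ((a *ₘ b') +ₘ (b *ₘ d'))
        ((c *ₘ a') +ₘ (d *ₘ c')) ((c *ₘ b') +ₘ (d *ₘ d'))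

  O I : Mat
  O = mat 0ₘ 0ₘ 0ₘ 0ₘ
  I = mat 1ₘ 0ₘ 0ₘ 1ₘ

  IsIdempotent : Mat → Set
  IsIdempotent e = e · e ≡ e

  IsUnit : Mat → Set
  IsUnit u = ∃ λ v → u · v ≡ I × v · u ≡ I

  isUnit? : ∀ u → Dec (IsUnit u)
  isUnit? u =
    map′ (λ { (a , b , c , d , h) → mat a b c d , h })
         (λ { (mat a b c d , h) → a , b , c , d , h })
         (FP.any? λ a → FP.any? λ b → FP.any? λ c → FP.any? λ d →
            ((u · mat a b c d) ≟M I) ×-dec ((mat a b c d · u) ≟M I))

  -- vertices of Cl₂(M₂(ℤ_m)): pairs (e , u), e a nonzero idempotent, u a unit
  -- (membership proofs are the proof-irrelevant True/False of the decisions)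
  record ClVertex : Set where
    constructor vtx
    field
      e u     : Mat
      e-idem  : True (e · e ≟M e)
      e-nz    : False (e ≟M O)
      u-unit  : True (isUnit? u)

  ClAdj : ClVertex → ClVertex → Set
  ClAdj (vtx e u _ _ _) (vtx f v _ _ _) =
    ((e , u) ≢ (f , v)) × ((e · f ≡ O × f · e ≡ O) ⊎ (u · v ≡ I × v · u ≡ I))

  Cl₂M₂ : Graph
  Cl₂M₂ = record { Vertex = ClVertex ; _~_ = ClAdj }

Cl₂M₂ℤ : (p : ℕ) → Prime p → Graph
Cl₂M₂ℤ p pp = Zmod.Cl₂M₂ p {{prime⇒nonZero pp}}

module Submission where

-- A vertex (e , u) of Cl₂(M₂(ℤ_p)) is adjacent to (f , v) when e, f are orthogonal or u, v are
-- mutually inverse, so the graph is governed by two involutions: u ↦ u⁻¹ on the units, and on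
-- the nonzero idempotents e ↦ I - e, with I fixed.  The second really describes orthogonality:
-- an idempotent other than O and I has trace 1, so for orthogonal nonzero idempotents e, f ≠ I the
-- idempotent e + f has trace 2 ≠ 1 and is O or I; and e + f = O would force e = O.
-- An involution of a finite set is determined up to conjugacy by its numbers of fixed points and
-- of 2-cycles.  Numbering the t fixed points of inversion first and the two ends of each 2-cycle
-- symmetrically about the middle of the remaining copies gives exactly the index pattern of the
-- shuriken graph, and the idempotent involution, with its single fixed point, is k K₂ plus the
-- isolated vertex.  It remains to count: |GL₂(ℤ_p)| = (p² - 1)(p² - p) by choosing rows; the
-- nonzero idempotents are I and the mat a b c (1 - a) with a - a² = bc, 1 + p(p - 1) + 2p in all;
-- the square roots of I are ± I (for p odd) and the mat a b c (- a) with a² + bc = 1, which gives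
-- t = p² + p + 2 for p odd, and t = 4 for p = 2.

open import Level using (0ℓ)
open import Data.Nat using (ℕ; NonZero)
open import Data.Nat.Primality using (Prime)
open import Algebra.Bundles using (CommutativeRing; Ring)

module FiniteCounting where

  open import Data.Nat using (ℕ; zero; suc; _+_; _*_; _∸_)
  open import Data.Nat.Properties using (m+n∸m≡n)
  open import Data.Fin using (Fin)
  import Data.Fin as F
  open import Data.Fin.Properties using (+↔⊎; *↔×; 0↔⊥; 1↔⊤; 2↔Bool)
  open import Data.Fin.Permutation using (↔⇒≡)
  open import Data.Bool using (Bool; true; false; T)
  open import Data.Bool.Properties using (T-irrelevant)
  open import Data.Empty using (⊥-elim)
  open import Data.Product using (Σ; ∃; _×_; _,_)
  open import Data.Product.Properties using (Σ-≡,≡→≡)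
  open import Data.Product.Function.NonDependent.Propositional using (_×-↔_)
  import Data.Product.Function.Dependent.Propositional as Σ
  open import Data.Sum using (_⊎_; inj₁; inj₂)
  open import Data.Sum.Function.Propositional using (_⊎-↔_)
  open import Relation.Nullary using (Dec; yes; no; isYes; isNo)
  open import Relation.Nullary.Decidable using (True; False; toWitness; fromWitness; fromWitnessFalse)
  open import Relation.Unary using (Decidable)
  open import Relation.Binary.Definitions using (DecidableEquality)
  open import Relation.Binary.PropositionalEquality
  open import Function using (_↔_; Inverse; mk↔ₛ′; _∘_)
  open import Function.Related.Propositional using (bijection)
  open import Function.Properties.Inverse using (↔-sym; ↔-trans; ↔-refl)

  open Inverse public using (to; from; strictlyInverseˡ; strictlyInverseʳ)

  infix 4 _HasSize_

  _HasSize_ : Set → ℕ → Set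
  A HasSize n = A ↔ Fin n

  to-injective : ∀ {A B : Set} (f : A ↔ B) {x y} → to f x ≡ to f y → x ≡ y
  to-injective f {x} {y} eq = begin
    x                ≡⟨ strictlyInverseʳ f x ⟨
    from f (to f x)  ≡⟨ cong (from f) eq ⟩
    from f (to f y)  ≡⟨ strictlyInverseʳ f y ⟩
    y                ∎
    where open ≡-Reasoning

  size-unique : ∀ {A m n} → A HasSize m → A HasSize n → m ≡ n
  size-unique f g = ↔⇒≡ (↔-trans (↔-sym f) g)

  size-⊎ : ∀ {A B m n} → A HasSize m → B HasSize n → (A ⊎ B) HasSize (m + n)
  size-⊎ f g = ↔-trans (f ⊎-↔ g) (↔-sym +↔⊎)

  size-× : ∀ {A B m n} → A HasSize m → B HasSize n → (A × B) HasSize (m * n)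
  size-× f g = ↔-trans (f ×-↔ g) (↔-sym *↔×)

  size-Σ : ∀ {A : Set} {B : A → Set} {m n} →
           A HasSize m → (∀ a → B a HasSize n) → Σ A B HasSize (m * n)
  size-Σ f g = ↔-trans (Σ.congˡ {k = bijection} (g _)) (size-× f ↔-refl)

  size-Bool : Bool HasSize 2
  size-Bool = ↔-sym 2↔Bool

  size-T : (b : Bool) → ∃ λ k → T b HasSize k
  size-T true  = 1 , ↔-sym 1↔⊤
  size-T false = 0 , ↔-sym 0↔⊥

  T-head-tail : ∀ {n} (b : Fin (suc n) → Bool) →
                Σ (Fin (suc n)) (T ∘ b) ↔ (T (b F.zero) ⊎ Σ (Fin n) (T ∘ b ∘ F.suc))
  T-head-tail b = mk↔ₛ′ split join split∘join join∘split
    where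
    split : Σ (Fin _) (T ∘ b) → T (b F.zero) ⊎ Σ (Fin _) (T ∘ b ∘ F.suc)
    split (F.zero  , t) = inj₁ t
    split (F.suc i , t) = inj₂ (i , t)
    join : T (b F.zero) ⊎ Σ (Fin _) (T ∘ b ∘ F.suc) → Σ (Fin _) (T ∘ b)
    join (inj₁ t)       = F.zero , t
    join (inj₂ (i , t)) = F.suc i , t
    split∘join : ∀ y → split (join y) ≡ y
    split∘join (inj₁ _) = refl
    split∘join (inj₂ _) = refl
    join∘split : ∀ x → join (split x) ≡ x
    join∘split (F.zero  , _) = refl
    join∘split (F.suc _ , _) = refl

  size-T-Fin : ∀ n (b : Fin n → Bool) → ∃ λ k → Σ (Fin n) (T ∘ b) HasSize k
  size-T-Fin zero    b = 0 , mk↔ₛ′ (λ ()) (λ ()) (λ ()) (λ ())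
  size-T-Fin (suc n) b with size-T (b F.zero) | size-T-Fin n (b ∘ F.suc)
  ... | k , head | l , tail = k + l , ↔-trans (T-head-tail b) (size-⊎ head tail)

  Σ-T-along : ∀ {A B : Set} (e : A ↔ B) (b : A → Bool) → Σ A (T ∘ b) ↔ Σ B (T ∘ b ∘ from e)
  Σ-T-along e b = mk↔ₛ′ forth back forth∘back back∘forth
    where
    forth : Σ _ (T ∘ b) → Σ _ (T ∘ b ∘ from e)
    forth (x , t) = to e x , subst (T ∘ b) (sym (strictlyInverseʳ e x)) t
    back : Σ _ (T ∘ b ∘ from e) → Σ _ (T ∘ b)
    back (y , t) = from e y , t
    forth∘back : ∀ y → forth (back y) ≡ y
    forth∘back (y , t) = Σ-≡,≡→≡ (strictlyInverseˡ e y , T-irrelevant _ _)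
    back∘forth : ∀ x → back (forth x) ≡ x
    back∘forth (x , t) = Σ-≡,≡→≡ (strictlyInverseʳ e x , T-irrelevant _ _)

  size-T-finite : ∀ {A N} → A HasSize N → (b : A → Bool) → ∃ λ k → Σ A (T ∘ b) HasSize k
  size-T-finite {N = N} e b with size-T-Fin N (b ∘ from e)
  ... | k , c = k , ↔-trans (Σ-T-along e b) c

  module _ {A : Set} {P : A → Set} (P? : Decidable P) where

    Sat Unsat : Set
    Sat   = Σ A λ x → True (P? x)
    Unsat = Σ A λ x → False (P? x)

    Sat≡ : ∀ {x y} {px : True (P? x)} {py : True (P? y)} → x ≡ y → (x , px) ≡ (y , py)
    Sat≡ refl = cong (_ ,_) (T-irrelevant _ _)

    Unsat≡ : ∀ {x y} {px : False (P? x)} {py : False (P? y)} → x ≡ y → (x , px) ≡ (y , py)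
    Unsat≡ refl = cong (_ ,_) (T-irrelevant _ _)

    size-Sat : ∀ {N} → A HasSize N → ∃ λ k → Sat HasSize k
    size-Sat e = size-T-finite e (isYes ∘ P?)

    Sat⊎Unsat : A ↔ (Sat ⊎ Unsat)
    Sat⊎Unsat = mk↔ₛ′ (λ x → classify x (P? x)) merge classify∘merge (λ x → merge∘classify x (P? x))
      where
      classify : ∀ x → Dec (P x) → Sat ⊎ Unsat
      classify x (yes px) = inj₁ (x , fromWitness px)
      classify x (no ¬px) = inj₂ (x , fromWitnessFalse ¬px)
      merge : Sat ⊎ Unsat → A
      merge (inj₁ (x , _)) = x
      merge (inj₂ (x , _)) = x
      merge∘classify : ∀ x d → merge (classify x d) ≡ x
      merge∘classify x (yes _) = refl
      merge∘classify x (no _)  = refl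
      classify-Sat : ∀ x (d : Dec (P x)) (t : True (P? x)) → T (isYes d) → classify x d ≡ inj₁ (x , t)
      classify-Sat x (yes _) t _ = cong inj₁ (Sat≡ refl)
      classify-Unsat : ∀ x (d : Dec (P x)) (f : False (P? x)) → T (isNo d) → classify x d ≡ inj₂ (x , f)
      classify-Unsat x (no _) f _ = cong inj₂ (Unsat≡ refl)
      classify∘merge : ∀ y → classify (merge y) (P? (merge y)) ≡ y
      classify∘merge (inj₁ (x , t)) = classify-Sat x (P? x) t t
      classify∘merge (inj₂ (x , f)) = classify-Unsat x (P? x) f f

    size-Unsat : ∀ {N m} → A HasSize N → Sat HasSize m → Unsat HasSize (N ∸ m)
    size-Unsat {N} {m} e sat with size-T-finite e (isNo ∘ P?)
    ... | k , unsat = subst (Unsat HasSize_) k≡N∸m unsat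
      where
      k≡N∸m : k ≡ N ∸ m
      k≡N∸m = trans (sym (m+n∸m≡n m k))
                    (cong (_∸ m) (size-unique (size-⊎ sat unsat) (↔-trans (↔-sym Sat⊎Unsat) e)))

    size-Sat-one : ∀ {u} → P u → (∀ x → P x → x ≡ u) → Sat HasSize 1
    size-Sat-one {u} pu only-u =
      mk↔ₛ′ (λ _ → F.zero) (λ _ → u , fromWitness pu) (λ { F.zero → refl ; (F.suc ()) })
            (λ (x , t) → Sat≡ (sym (only-u x (toWitness t))))

    size-Sat-two : DecidableEquality A → ∀ {u v} → u ≢ v → P u → P v →
                   (∀ x → P x → x ≡ u ⊎ x ≡ v) → Sat HasSize 2
    size-Sat-two _≟_ {u} {v} u≢v pu pv only-u-v = ↔-trans (mk↔ₛ′ forth back forth∘back back∘forth) size-Bool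
      where
      isV : ∀ x → Dec (x ≡ u) → Bool
      isV x (yes _) = false
      isV x (no _)  = true
      forth : Sat → Bool
      forth (x , _) = isV x (x ≟ u)
      back : Bool → Sat
      back false = u , fromWitness pu
      back true  = v , fromWitness pv
      isV-u : ∀ d → isV u d ≡ false
      isV-u (yes _)  = refl
      isV-u (no u≢u) = ⊥-elim (u≢u refl)
      isV-v : ∀ d → isV v d ≡ true
      isV-v (yes v≡u) = ⊥-elim (u≢v (sym v≡u))
      isV-v (no _)    = refl
      forth∘back : ∀ b → forth (back b) ≡ b
      forth∘back false = isV-u (u ≟ u)
      forth∘back true  = isV-v (v ≟ u)
      back-isV : ∀ x → P x → ∀ d t → back (isV x d) ≡ (x , t)
      back-isV x px (yes x≡u) t = Sat≡ (sym x≡u)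
      back-isV x px (no x≢u)  t with only-u-v x px
      ... | inj₁ x≡u = ⊥-elim (x≢u x≡u)
      ... | inj₂ x≡v = Sat≡ (sym x≡v)
      back∘forth : ∀ y → back (forth y) ≡ y
      back∘forth (x , t) = back-isV x (toWitness t) (x ≟ u) t

module InvolutionOrbits where

  open import Data.Nat using (ℕ; _+_; _*_; _<_; _<?_)
  open import Data.Nat.Properties using (<-irrefl; <-asym; ≮⇒≥; ≤∧≢⇒<; *-comm; +-identityʳ)
  open import Data.Fin using (Fin; toℕ)
  open import Data.Fin.Properties using (toℕ-injective)
  open import Data.Bool using (Bool; true; false; not)
  open import Data.Bool.Properties using (T-irrelevant)
  open import Data.Empty using (⊥-elim)
  open import Data.Product using (_×_; _,_; proj₁; proj₂)
  open import Data.Product.Function.NonDependent.Propositional using (_×-↔_)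
  open import Data.Sum using (_⊎_; inj₁; inj₂)
  open import Data.Sum.Function.Propositional using (_⊎-↔_)
  open import Relation.Nullary using (¬_; Dec; yes; no)
  open import Relation.Nullary.Decidable using (toWitness; fromWitness)
  open import Relation.Binary.Definitions using (DecidableEquality)
  open import Relation.Binary.PropositionalEquality
  open import Function using (_↔_; _⇔_; mk↔ₛ′; mk⇔; _∘_; Equivalence)
  open import Function.Properties.Inverse using (↔-trans; ↔-refl)
  open FiniteCounting

  Orbits : ℕ → ℕ → Set
  Orbits t k = Fin t ⊎ (Fin k × Bool)

  flip : ∀ {t k} → Orbits t k → Orbits t k
  flip (inj₁ i)       = inj₁ i
  flip (inj₂ (j , b)) = inj₂ (j , not b)

  size-Orbits : ∀ t k → Orbits t k HasSize (t + (k + k))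
  size-Orbits t k = size-⊎ ↔-refl (subst ((Fin k × Bool) HasSize_) k*2≡k+k (size-× ↔-refl size-Bool))
    where
    k*2≡k+k : k * 2 ≡ k + k
    k*2≡k+k = trans (*-comm k 2) (cong (k +_) (+-identityʳ k))

  module _ {U : Set} (_≟_ : DecidableEquality U)
           (σ : U → U) (σ-involutive : ∀ x → σ (σ x) ≡ x) where

    Fixed : Set
    Fixed = Sat (λ x → σ x ≟ x)

    record FlipConjugacy (t : ℕ) : Set where
      field
        pairs  : ℕ
        conj   : U ↔ Orbits t pairs
        conj-σ : ∀ x → to conj (σ x) ≡ flip (to conj x)

      σ⇔flip : ∀ x y → (y ≡ σ x) ⇔ (to conj y ≡ flip (to conj x))
      σ⇔flip x y = mk⇔ (λ { refl → conj-σ x })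
                       (λ eq → to-injective conj (trans eq (sym (conj-σ x))))

      moved-partner⇔ : ∀ x y → (σ x ≢ x × y ≡ σ x) ⇔ (flip (to conj x) ≢ to conj x × to conj y ≡ flip (to conj x))
      moved-partner⇔ x y = mk⇔
        (λ (moved , y≡σx) → (λ fixed → moved (to-injective conj (trans (conj-σ x) fixed))) ,
                            Equivalence.to (σ⇔flip x y) y≡σx)
        (λ (moved , flipped) → (λ fixed → moved (trans (sym (conj-σ x)) (cong (to conj) fixed))) ,
                               Equivalence.from (σ⇔flip x y) flipped)

    module _ {N : ℕ} (size : U HasSize N) where

      private
        index : U → ℕ
        index x = toℕ (to size x)

        index-injective : ∀ {x y} → index x ≡ index y → x ≡ y
        index-injective eq = to-injective size (toℕ-injective eq)

        Leader : U → Set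
        Leader x = index x < index (σ x)

        leader? : ∀ x → Dec (Leader x)
        leader? x = index x <? index (σ x)

      -- each orbit {x , σ x} of size two is represented by its element of smaller index
      Leaders : Set
      Leaders = Sat leader?

      private
        Y : Set
        Y = Fixed ⊎ (Leaders × Bool)

        flipY : Y → Y
        flipY (inj₁ x)       = inj₁ x
        flipY (inj₂ (r , b)) = inj₂ (r , not b)

        leader⇒moved : ∀ {x} → Leader x → σ x ≢ x
        leader⇒moved lt eq = <-irrefl (sym (cong index eq)) lt

        follower⇒partner-leads : ∀ {x} → σ x ≢ x → ¬ Leader x → Leader (σ x)
        follower⇒partner-leads {x} moved ¬lead rewrite σ-involutive x =
          ≤∧≢⇒< (≮⇒≥ ¬lead) (λ eq → moved (index-injective eq))

        encode′ : ∀ x → Dec (σ x ≡ x) → Dec (Leader x) → Y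
        encode′ x (yes fixed) _        = inj₁ (x , fromWitness fixed)
        encode′ x (no moved) (yes lead) = inj₂ ((x , fromWitness lead) , false)
        encode′ x (no moved) (no ¬lead) = inj₂ ((σ x , fromWitness (follower⇒partner-leads moved ¬lead)) , true)

        encode : U → Y
        encode x = encode′ x (σ x ≟ x) (leader? x)

        decode : Y → U
        decode (inj₁ (x , _))           = x
        decode (inj₂ ((r , _) , false)) = r
        decode (inj₂ ((r , _) , true))  = σ r

        decode∘encode′ : ∀ x d e → decode (encode′ x d e) ≡ x
        decode∘encode′ x (yes _) _      = refl
        decode∘encode′ x (no _) (yes _) = refl
        decode∘encode′ x (no _) (no _)  = σ-involutive x

        decode∘encode : ∀ x → decode (encode x) ≡ x
        decode∘encode x = decode∘encode′ x (σ x ≟ x) (leader? x)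

        encode-fixed : ∀ x d e t → encode′ x d e ≡ inj₁ (x , t)
        encode-fixed x (yes _) _ t    = cong inj₁ (Sat≡ _ refl)
        encode-fixed x (no moved) _ t = ⊥-elim (moved (toWitness t))

        encode-leader : ∀ r d e t → encode′ r d e ≡ inj₂ ((r , t) , false)
        encode-leader r (yes fixed) _ t   = ⊥-elim (leader⇒moved (toWitness t) fixed)
        encode-leader r (no _) (yes _) t  = cong (λ t → inj₂ ((r , t) , false)) (T-irrelevant _ _)
        encode-leader r (no _) (no ¬lead) t = ⊥-elim (¬lead (toWitness t))

        encode-follower : ∀ r d e t → encode′ (σ r) d e ≡ inj₂ ((r , t) , true)
        encode-follower r (yes fixed) _ t =
          ⊥-elim (leader⇒moved (toWitness t) (trans (sym fixed) (σ-involutive r)))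
        encode-follower r (no _) (yes lead) t =
          ⊥-elim (<-asym (toWitness t) (subst (λ z → index (σ r) < index z) (σ-involutive r) lead))
        encode-follower r (no _) (no _) t = cong (λ l → inj₂ (l , true)) (Sat≡ _ (σ-involutive r))

        encode∘decode : ∀ y → encode (decode y) ≡ y
        encode∘decode (inj₁ (x , t))           = encode-fixed x _ _ t
        encode∘decode (inj₂ ((r , t) , false)) = encode-leader r _ _ t
        encode∘decode (inj₂ ((r , t) , true))  = encode-follower r _ _ t

        encode-σ : ∀ x → encode (σ x) ≡ flipY (encode x)
        encode-σ x = trans (cong (encode ∘ σ) (sym (decode∘encode x))) (on-decoded (encode x))
          where
          on-decoded : ∀ y → encode (σ (decode y)) ≡ flipY y
          on-decoded (inj₁ (x , t))           = trans (cong encode (toWitness t)) (encode∘decode (inj₁ (x , t)))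
          on-decoded (inj₂ ((r , t) , false)) = encode∘decode (inj₂ ((r , t) , true))
          on-decoded (inj₂ ((r , t) , true))  = trans (cong encode (σ-involutive r)) (encode∘decode (inj₂ ((r , t) , false)))

      -- opaque, so that the number of pairs is never computed by running the enumeration
      opaque
        flipConjugacy : ∀ {t} → Fixed HasSize t → FlipConjugacy t
        flipConjugacy {t} fixed = record
          { pairs  = pairs
          ; conj   = ↔-trans (mk↔ₛ′ encode decode encode∘decode decode∘encode) relabel
          ; conj-σ = λ x → trans (cong (to relabel) (encode-σ x)) (relabel-flip (encode x))
          }
          where
          pairs : ℕ
          pairs = proj₁ (size-Sat leader? size)
          relabel : Y ↔ Orbits t pairs
          relabel = fixed ⊎-↔ (proj₂ (size-Sat leader? size) ×-↔ ↔-refl)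
          relabel-flip : ∀ y → to relabel (flipY y) ≡ flip (to relabel y)
          relabel-flip (inj₁ _)           = refl
          relabel-flip (inj₂ (_ , false)) = refl
          relabel-flip (inj₂ (_ , true))  = refl

module ShurikenLayout where

  open import Data.Nat using (ℕ; suc; _+_; _*_; _∸_; _≤_; _<_; _/_; s≤s; s≤s⁻¹)
  open import Data.Nat.Properties
    using (+-comm; +-suc; m≤m+n; +-monoʳ-≤; <⇒≱; m+n∸n≡m; m+[n∸m]≡n; suc-injective;
           ≤-trans; ≤-<-trans; m∸n+n≡m; +-mono-≤; *-comm; +-identityʳ; n<1+n)
  open import Data.Nat.DivMod using (m*n/n≡m; m/n≤m; m/n*n≤m)
  open import Data.Nat.Tactic.RingSolver using (solve-∀)
  open import Data.Fin using (Fin; toℕ; opposite)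
  open import Data.Fin.Properties
    using (+↔⊎; toℕ<n; toℕ-injective; toℕ-↑ˡ; toℕ-↑ʳ; opposite-prop; opposite-involutive)
  open import Data.Bool using (Bool; true; false)
  open import Data.Empty using (⊥-elim)
  open import Relation.Nullary using (¬_)
  open import Data.Product using (∃; _×_; _,_)
  open import Data.Sum using (_⊎_; inj₁; inj₂)
  open import Data.Sum.Function.Propositional using (_⊎-↔_)
  open import Relation.Binary.PropositionalEquality
  open import Function using (_↔_; _⇔_; mk↔ₛ′; mk⇔)
  open import Function.Properties.Inverse using (↔-sym; ↔-trans; ↔-refl)
  open FiniteCounting
  open InvolutionOrbits

  Full : ∀ {n} (t : ℕ) → Fin n → Fin n → Set
  Full t i j = i ≡ j × suc (toℕ i) ≤ t

  Cross : ∀ {n} (t : ℕ) → Fin n → Fin n → Set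
  Cross {n} t i j = t + 1 ≤ suc (toℕ i) × suc (toℕ i) ≤ (n + t) / 2 × suc (toℕ j) ≡ (n + t + 1) ∸ suc (toℕ i)

  ShuLink : ∀ {n} (t : ℕ) → Fin n → Fin n → Set
  ShuLink t i j = Full t i j ⊎ Cross t i j ⊎ Cross t j i

  -- Cross t i i would give 2 (i + 1) = n + t + 1 although i + 1 ≤ (n + t) / 2
  Cross-irreflexive : ∀ {n t} {i : Fin n} → ¬ Cross t i i
  Cross-irreflexive {n} {t} {i} (_ , before , partner) = <⇒≱ below above
    where
    s = n + t
    i+1≤s : suc (toℕ i) ≤ s
    i+1≤s = ≤-trans before (m/n≤m s 2)
    twice : suc (toℕ i) + suc (toℕ i) ≡ s + 1
    twice = trans (cong (_+ suc (toℕ i)) partner) (m∸n+n≡m (≤-trans i+1≤s (m≤m+n s 1)))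
    above : s + 1 ≤ s / 2 * 2
    above = subst₂ _≤_ twice (trans (cong (s / 2 +_) (sym (+-identityʳ (s / 2)))) (*-comm 2 (s / 2)))
                   (+-mono-≤ before before)
    below : s / 2 * 2 < s + 1
    below = ≤-<-trans (m/n*n≤m s 2) (subst (s <_) (+-comm 1 s) (n<1+n s))

  module _ (t k : ℕ) where

    private
      n : ℕ
      n = t + (k + k)

    -- the fixed points take the first t copies; the pair (j , false) , (j , true) takes copies
    -- t + j and t + 2k - 1 - j, which are swapped by i ↦ n + t + 1 - i in 1-based numbering
    layout : Orbits t k ↔ Fin n
    layout = ↔-trans (↔-refl ⊎-↔ ↔-trans mirror (↔-sym +↔⊎)) (↔-sym +↔⊎)
      where
      mirror : (Fin k × Bool) ↔ (Fin k ⊎ Fin k)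
      mirror = mk↔ₛ′ forth back forth∘back back∘forth
        where
        forth : Fin k × Bool → Fin k ⊎ Fin k
        forth (j , false) = inj₁ j
        forth (j , true)  = inj₂ (opposite j)
        back : Fin k ⊎ Fin k → Fin k × Bool
        back (inj₁ j) = j , false
        back (inj₂ j) = opposite j , true
        forth∘back : ∀ y → forth (back y) ≡ y
        forth∘back (inj₁ j) = refl
        forth∘back (inj₂ j) = cong inj₂ (opposite-involutive j)
        back∘forth : ∀ x → back (forth x) ≡ x
        back∘forth (j , false) = refl
        back∘forth (j , true)  = cong (_, true) (opposite-involutive j)

    private
      pos : Orbits t k → ℕ
      pos x = toℕ (to layout x)

      pos-fixed : ∀ i → pos (inj₁ i) ≡ toℕ i
      pos-fixed i = toℕ-↑ˡ i (k + k)

      pos-false : ∀ j → pos (inj₂ (j , false)) ≡ t + toℕ j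
      pos-false j = trans (toℕ-↑ʳ t _) (cong (t +_) (toℕ-↑ˡ j k))

      pos-true : ∀ j → pos (inj₂ (j , true)) ≡ t + (k + (k ∸ suc (toℕ j)))
      pos-true j = trans (toℕ-↑ʳ t _) (cong (t +_) (trans (toℕ-↑ʳ k _) (cong (k +_) (opposite-prop j))))

      half : (n + t) / 2 ≡ t + k
      half = trans (cong (_/ 2) (twice t k)) (m*n/n≡m (t + k) 2)
        where
        twice : ∀ t k → t + (k + k) + t ≡ (t + k) * 2
        twice = solve-∀

      partner : ∀ j → (n + t + 1) ∸ suc (pos (inj₂ (j , false))) ≡ suc (pos (inj₂ (j , true)))
      partner j = begin
        (n + t + 1) ∸ suc (pos (inj₂ (j , false)))
          ≡⟨ cong₂ (λ m l → (t + (m + m) + t + 1) ∸ suc l) (sym k≡) (pos-false j) ⟩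
        (t + ((suc (toℕ j) + r) + (suc (toℕ j) + r)) + t + 1) ∸ suc (t + toℕ j)
          ≡⟨ cong (_∸ suc (t + toℕ j)) (regroup t (toℕ j) r) ⟩
        (suc (t + ((suc (toℕ j) + r) + r)) + suc (t + toℕ j)) ∸ suc (t + toℕ j)
          ≡⟨ m+n∸n≡m _ (suc (t + toℕ j)) ⟩
        suc (t + ((suc (toℕ j) + r) + r))
          ≡⟨ cong (λ m → suc (t + (m + r))) k≡ ⟩
        suc (t + (k + r))
          ≡⟨ cong suc (pos-true j) ⟨
        suc (pos (inj₂ (j , true))) ∎
        where
        open ≡-Reasoning
        r = k ∸ suc (toℕ j)
        k≡ : suc (toℕ j) + r ≡ k
        k≡ = m+[n∸m]≡n (toℕ<n j)
        regroup : ∀ t j r → t + ((suc j + r) + (suc j + r)) + t + 1 ≡ suc (t + ((suc j + r) + r)) + suc (t + j)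
        regroup = solve-∀

      cross-pair : ∀ j → Cross t (to layout (inj₂ (j , false))) (to layout (inj₂ (j , true)))
      cross-pair j = after-fixed , before-half , partner-position
        where
        after-fixed : t + 1 ≤ suc (pos (inj₂ (j , false)))
        after-fixed rewrite pos-false j | +-comm t 1 = s≤s (m≤m+n t (toℕ j))
        before-half : suc (pos (inj₂ (j , false))) ≤ (n + t) / 2
        before-half rewrite pos-false j | half = subst (_≤ t + k) (+-suc t (toℕ j)) (+-monoʳ-≤ t (toℕ<n j))
        partner-position : suc (pos (inj₂ (j , true))) ≡ (n + t + 1) ∸ suc (pos (inj₂ (j , false)))
        partner-position = sym (partner j)

      cross-inversion : ∀ x y → Cross t (to layout x) (to layout y) →
                        ∃ λ j → x ≡ inj₂ (j , false) × y ≡ inj₂ (j , true)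
      cross-inversion (inj₁ i) y (after-fixed , _) rewrite pos-fixed i | +-comm t 1 =
        ⊥-elim (<⇒≱ (toℕ<n i) (s≤s⁻¹ after-fixed))
      cross-inversion (inj₂ (j , true)) y (_ , before-half , _) rewrite pos-true j | half =
        ⊥-elim (<⇒≱ before-half (+-monoʳ-≤ t (m≤m+n k _)))
      cross-inversion (inj₂ (j , false)) y (_ , _ , partner-position) =
        j , refl , to-injective layout (toℕ-injective (suc-injective (trans partner-position (partner j))))

      full-inversion : ∀ x y → Full t (to layout x) (to layout y) → ∃ λ i → x ≡ inj₁ i × y ≡ inj₁ i
      full-inversion (inj₁ i) y (same , _) = i , refl , sym (to-injective layout same)
      full-inversion (inj₂ (j , false)) y (_ , fixed) rewrite pos-false j = ⊥-elim (<⇒≱ fixed (m≤m+n t _))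
      full-inversion (inj₂ (j , true)) y (_ , fixed) rewrite pos-true j = ⊥-elim (<⇒≱ fixed (m≤m+n t _))

    flip⇔ShuLink : ∀ x y → (y ≡ flip x) ⇔ ShuLink t (to layout x) (to layout y)
    flip⇔ShuLink x y = mk⇔ (link x y) (unlink x y)
      where
      link : ∀ x y → y ≡ flip x → ShuLink t (to layout x) (to layout y)
      link (inj₁ i) _ refl = inj₁ (refl , subst (λ m → suc m ≤ t) (sym (pos-fixed i)) (toℕ<n i))
      link (inj₂ (j , false)) _ refl = inj₂ (inj₁ (cross-pair j))
      link (inj₂ (j , true)) _ refl = inj₂ (inj₂ (cross-pair j))
      unlink : ∀ x y → ShuLink t (to layout x) (to layout y) → y ≡ flip x
      unlink x y (inj₁ full) with full-inversion x y full
      ... | _ , refl , refl = refl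
      unlink x y (inj₂ (inj₁ cross)) with cross-inversion x y cross
      ... | _ , refl , refl = refl
      unlink x y (inj₂ (inj₂ cross)) with cross-inversion y x cross
      ... | _ , refl , refl = refl

module ShurikenIsomorphism where

  open import Data.Nat using (ℕ; suc; _≤_; NonZero)
  open import Data.Fin using (Fin; toℕ; zero)
  open import Data.Maybe using (Maybe; just; nothing)
  open import Data.Empty using (⊥)
  open import Data.Product using (Σ; _×_; _,_; proj₁; proj₂)
  open import Data.Bool using (Bool)
  open import Data.Bool.Properties using (T-irrelevant; not-¬; ¬-not)
  open import Data.Sum.Properties using (inj₂-injective)
  open import Data.Sum using (_⊎_; inj₁; inj₂)
  open import Relation.Nullary using (¬_; contradiction)
  open import Relation.Nullary.Decidable using (True; False; toWitness; toWitnessFalse)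
  open import Relation.Binary.PropositionalEquality
  open import Function using (_↔_; _⇔_; mk↔ₛ′; mk⇔; Equivalence; _∘_)
  open import Function.Properties.Inverse using (↔⇒⤖)
  open import Defs
  open FiniteCounting
  open ShurikenLayout
  open InvolutionOrbits using (Orbits; flip)

  _⁺ : Graph → Graph
  G ⁺ = record { Vertex = Maybe (Vertex G) ; _~_ = adjacent }
    where
    adjacent : Maybe (Vertex G) → Maybe (Vertex G) → Set
    adjacent (just u) (just v) = _~_ G u v
    adjacent _        _        = ⊥

  module _ {t n : ℕ} {G : Graph} where

    ShuEdge⇔ : ∀ {i x j y} → ShuEdge t n G (i , x) (j , y) ⇔
               (_~_ (G ⁺) x y ⊎ (i ≡ j × suc (toℕ i) ≤ t × x ≢ y) ⊎ Cross t i j)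
    ShuEdge⇔ = mk⇔ classify build
      where
      classify : ∀ {i x j y} → ShuEdge t n G (i , x) (j , y) →
                 _~_ (G ⁺) x y ⊎ (i ≡ j × suc (toℕ i) ≤ t × x ≢ y) ⊎ Cross t i j
      classify (base i j u v u~v)            = inj₁ u~v
      classify (full i x y fixed distinct)   = inj₂ (inj₁ (refl , fixed , λ x≡y → distinct (cong (i ,_) x≡y)))
      classify (cross i j x y after before partner) = inj₂ (inj₂ (after , before , partner))
      build : ∀ {i x j y} → _~_ (G ⁺) x y ⊎ (i ≡ j × suc (toℕ i) ≤ t × x ≢ y) ⊎ Cross t i j →
              ShuEdge t n G (i , x) (j , y)
      build {i} {just u} {j} {just v} (inj₁ u~v)           = base i j u v u~v
      build {i} {x} (inj₂ (inj₁ (refl , fixed , distinct))) = full i x _ fixed (λ eq → distinct (cong proj₂ eq))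
      build {i} {x} {j} {y} (inj₂ (inj₂ (after , before , partner))) = cross i j x y after before partner

  module _ {k : ℕ} where

    orbits↔K₂⁺ : Orbits 1 k ↔ Vertex (k K₂ ⁺)
    orbits↔K₂⁺ = mk↔ₛ′ forth back forth∘back back∘forth
      where
      forth : Orbits 1 k → Maybe (Fin k × Bool)
      forth (inj₁ _) = nothing
      forth (inj₂ x) = just x
      back : Maybe (Fin k × Bool) → Orbits 1 k
      back nothing  = inj₁ zero
      back (just x) = inj₂ x
      forth∘back : ∀ y → forth (back y) ≡ y
      forth∘back nothing  = refl
      forth∘back (just _) = refl
      back∘forth : ∀ x → back (forth x) ≡ x
      back∘forth (inj₁ zero) = refl
      back∘forth (inj₂ _)    = refl

    flip-partner⇔K₂⁺ : ∀ x y → (flip x ≢ x × y ≡ flip x) ⇔ _~_ (k K₂ ⁺) (to orbits↔K₂⁺ x) (to orbits↔K₂⁺ y)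
    flip-partner⇔K₂⁺ x y = mk⇔ (forth x y) (back x y)
      where
      forth : ∀ x y → flip x ≢ x × y ≡ flip x → _~_ (k K₂ ⁺) (to orbits↔K₂⁺ x) (to orbits↔K₂⁺ y)
      forth (inj₁ _)       _ (moved , _)    = contradiction refl moved
      forth (inj₂ (i , b)) _ (_ , refl)     = refl , not-¬ refl
      back : ∀ x y → _~_ (k K₂ ⁺) (to orbits↔K₂⁺ x) (to orbits↔K₂⁺ y) → flip x ≢ x × y ≡ flip x
      back (inj₂ (i , b)) (inj₂ (.i , c)) (refl , b≢c) =
        (λ eq → not-¬ refl (sym (cong proj₂ (inj₂-injective eq)))) , cong (λ c → inj₂ (i , c)) (¬-not (b≢c ∘ sym))

  module _ (m : ℕ) .{{_ : NonZero m}} where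

    open Zmod m

    NonzeroIdempotent : Set
    NonzeroIdempotent = Σ Mat λ e → True (e · e ≟M e) × False (e ≟M O)

    Unit : Set
    Unit = Σ Mat λ u → True (isUnit? u)

    Orthogonal : Mat → Mat → Set
    Orthogonal e f = e · f ≡ O × f · e ≡ O

    MutuallyInverse : Mat → Mat → Set
    MutuallyInverse u v = u · v ≡ I × v · u ≡ I

    NonzeroIdempotent≡ : ∀ {e f : NonzeroIdempotent} → proj₁ e ≡ proj₁ f → e ≡ f
    NonzeroIdempotent≡ {e , _} {.e , _} refl = cong (e ,_) (cong₂ _,_ (T-irrelevant _ _) (T-irrelevant _ _))

    Unit≡ : ∀ {u v : Unit} → proj₁ u ≡ proj₁ v → u ≡ v
    Unit≡ {u , _} {.u , _} refl = cong (u ,_) (T-irrelevant _ _)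

    ¬self-orthogonal : (e : NonzeroIdempotent) → ¬ Orthogonal (proj₁ e) (proj₁ e)
    ¬self-orthogonal (e , idem , nonzero) (e·e≡O , _) = toWitnessFalse nonzero (trans (sym (toWitness idem)) e·e≡O)

    module _ {a t n : ℕ}
      (φ : NonzeroIdempotent ↔ Vertex (a K₂ ⁺))
      (φ-orthogonal : ∀ e f → Orthogonal (proj₁ e) (proj₁ f) ⇔ _~_ (a K₂ ⁺) (to φ e) (to φ f))
      (ψ : Unit ↔ Fin n)
      (ψ-inverse : ∀ u v → MutuallyInverse (proj₁ u) (proj₁ v) ⇔ ShuLink t (to ψ u) (to ψ v))
      where

      private
        H : Graph
        H = Shu t n (a K₂)

        vertex : NonzeroIdempotent → Unit → ClVertex
        vertex (e , idem , nonzero) (u , unit) = vtx e u idem nonzero unit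

        Φ : ClVertex → Vertex H
        Φ (vtx e u idem nonzero unit) = to ψ (u , unit) , to φ (e , idem , nonzero)

        Ψ : Vertex H → ClVertex
        Ψ (i , x) = vertex (from φ x) (from ψ i)

        Φ∘Ψ : ∀ y → Φ (Ψ y) ≡ y
        Φ∘Ψ (i , x) = cong₂ _,_ (strictlyInverseˡ ψ i) (strictlyInverseˡ φ x)

        Ψ∘Φ : ∀ x → Ψ (Φ x) ≡ x
        Ψ∘Φ (vtx e u idem nonzero unit) = cong₂ vertex (strictlyInverseʳ φ _) (strictlyInverseʳ ψ _)

        ClAdj-sym : ∀ x y → ClAdj x y → ClAdj y x
        ClAdj-sym (vtx _ _ _ _ _) (vtx _ _ _ _ _) (distinct , inj₁ (ef , fe)) = distinct ∘ sym , inj₁ (fe , ef)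
        ClAdj-sym (vtx _ _ _ _ _) (vtx _ _ _ _ _) (distinct , inj₂ (uv , vu)) = distinct ∘ sym , inj₂ (vu , uv)

        adjacent⇒edge : ∀ x y → ClAdj x y → _~_ H (Φ x) (Φ y)
        adjacent⇒edge (vtx e u ei en uu) (vtx f v fi fn vu) (distinct , inj₁ orthogonal) =
          inj₁ (Equivalence.from ShuEdge⇔ (inj₁ (Equivalence.to (φ-orthogonal _ _) orthogonal)))
        adjacent⇒edge (vtx e u ei en uu) (vtx f v fi fn vu) (distinct , inj₂ inverse)
          with Equivalence.to (ψ-inverse (u , uu) (v , vu)) inverse
        ... | inj₁ (same , fixed) = inj₁ (Equivalence.from ShuEdge⇔ (inj₂ (inj₁ (same , fixed , φ-distinct))))
          where
          φ-distinct : to φ (e , ei , en) ≢ to φ (f , fi , fn)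
          φ-distinct eq = distinct (cong₂ _,_ (cong proj₁ (to-injective φ eq)) (cong proj₁ (to-injective ψ same)))
        ... | inj₂ (inj₁ paired) = inj₁ (Equivalence.from ShuEdge⇔ (inj₂ (inj₂ paired)))
        ... | inj₂ (inj₂ paired) = inj₂ (Equivalence.from ShuEdge⇔ (inj₂ (inj₂ paired)))

        edge⇒adjacent : ∀ x y → ShuEdge t n (a K₂) (Φ x) (Φ y) → ClAdj x y
        edge⇒adjacent (vtx e u ei en uu) (vtx f v fi fn vu) edge with Equivalence.to ShuEdge⇔ edge
        ... | inj₁ φ-adjacent = distinct , inj₁ orthogonal
          where
          orthogonal = Equivalence.from (φ-orthogonal _ _) φ-adjacent
          distinct : (e , u) ≢ (f , v)
          distinct eq = ¬self-orthogonal (e , ei , en) (subst (Orthogonal e) (sym (cong proj₁ eq)) orthogonal)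
        ... | inj₂ (inj₁ (same , fixed , φ-distinct)) = distinct , inj₂ inverse
          where
          inverse = Equivalence.from (ψ-inverse _ _) (inj₁ (same , fixed))
          distinct : (e , u) ≢ (f , v)
          distinct eq = φ-distinct (cong (to φ) (NonzeroIdempotent≡ (cong proj₁ eq)))
        ... | inj₂ (inj₂ paired) = distinct , inj₂ inverse
          where
          inverse = Equivalence.from (ψ-inverse _ _) (inj₂ (inj₁ paired))
          distinct : (e , u) ≢ (f , v)
          distinct eq = Cross-irreflexive (subst (Cross t _) (cong (to ψ) (Unit≡ {v , vu} {u , uu} (sym (cong proj₂ eq)))) paired)

      Cl₂M₂≅Shu : Cl₂M₂ ≅ Shu t n (a K₂)
      Cl₂M₂≅Shu = record
        { bij = ↔⇒⤖ (mk↔ₛ′ Φ Ψ Φ∘Ψ Ψ∘Φ)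
        ; adj = λ x y → mk⇔ (adjacent⇒edge x y) λ
            { (inj₁ edge) → edge⇒adjacent x y edge
            ; (inj₂ edge) → ClAdj-sym y x (edge⇒adjacent y x edge) }
        }

module IntegersModulo where

  open import Level using (0ℓ)
  open import Data.Nat using (ℕ; _+_; _*_; _∸_; _%_; NonZero; >-nonZero⁻¹)
  open import Data.Nat.Properties using (+-comm; *-comm; +-assoc; *-assoc; *-distribˡ-+; *-identityˡ; m∸n+n≡m; <⇒≤)
  open import Data.Nat.DivMod using (_mod_; %-distribˡ-+; %-distribˡ-*; m<n⇒m%n≡m; n%n≡0)
  open import Data.Fin using (toℕ)
  open import Data.Fin.Properties using (toℕ-fromℕ<; toℕ-injective; toℕ<n)
  open import Data.Product using (_,_)
  open import Algebra.Bundles using (CommutativeRing)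
  open import Algebra.Structures using (IsCommutativeRing)
  open import Relation.Binary.PropositionalEquality 
  open import Defs

  module _ (m : ℕ) .{{_ : NonZero m}} where

    open Zmod m
    open ≡-Reasoning

    -ₘ_ : Zm → Zm
    -ₘ x = (m ∸ toℕ x) mod m

    toℕ-mod : ∀ n → toℕ (n mod m) ≡ n % m
    toℕ-mod n = toℕ-fromℕ< _

    mod-cong : ∀ {a b} → a % m ≡ b % m → a mod m ≡ b mod m
    mod-cong eq = toℕ-injective (trans (toℕ-mod _) (trans eq (sym (toℕ-mod _))))

    mod-toℕ : ∀ x → toℕ x mod m ≡ x
    mod-toℕ x = toℕ-injective (trans (toℕ-mod _) (m<n⇒m%n≡m (toℕ<n x)))

    mod-self : m mod m ≡ 0ₘ
    mod-self = mod-cong (trans (n%n≡0 m) (sym (m<n⇒m%n≡m (>-nonZero⁻¹ m))))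

    mod-+ : ∀ a b → (a + b) mod m ≡ a mod m +ₘ b mod m
    mod-+ a b = mod-cong (trans (%-distribˡ-+ a b m) (cong (_% m) (sym (cong₂ _+_ (toℕ-mod a) (toℕ-mod b)))))

    mod-* : ∀ a b → (a * b) mod m ≡ (a mod m) *ₘ (b mod m)
    mod-* a b = mod-cong (trans (%-distribˡ-* a b m) (cong (_% m) (sym (cong₂ _*_ (toℕ-mod a) (toℕ-mod b)))))

    -- every law is a law of ℕ pushed through the surjective homomorphism _mod m
    private
      +-assoc-ₘ : ∀ x y z → (x +ₘ y) +ₘ z ≡ x +ₘ (y +ₘ z)
      +-assoc-ₘ x y z = begin
        (toℕ x + toℕ y) mod m +ₘ z              ≡⟨ cong ((toℕ x + toℕ y) mod m +ₘ_) (mod-toℕ z) ⟨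
        (toℕ x + toℕ y) mod m +ₘ toℕ z mod m    ≡⟨ mod-+ (toℕ x + toℕ y) (toℕ z) ⟨
        (toℕ x + toℕ y + toℕ z) mod m           ≡⟨ cong (_mod m) (+-assoc (toℕ x) (toℕ y) (toℕ z)) ⟩
        (toℕ x + (toℕ y + toℕ z)) mod m         ≡⟨ mod-+ (toℕ x) (toℕ y + toℕ z) ⟩
        toℕ x mod m +ₘ (toℕ y + toℕ z) mod m    ≡⟨ cong (_+ₘ (y +ₘ z)) (mod-toℕ x) ⟩
        x +ₘ (y +ₘ z)                           ∎

      *-assoc-ₘ : ∀ x y z → (x *ₘ y) *ₘ z ≡ x *ₘ (y *ₘ z)
      *-assoc-ₘ x y z = begin
        (toℕ x * toℕ y) mod m *ₘ z              ≡⟨ cong ((toℕ x * toℕ y) mod m *ₘ_) (mod-toℕ z) ⟨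
        (toℕ x * toℕ y) mod m *ₘ (toℕ z mod m) ≡⟨ mod-* (toℕ x * toℕ y) (toℕ z) ⟨
        (toℕ x * toℕ y * toℕ z) mod m           ≡⟨ cong (_mod m) (*-assoc (toℕ x) (toℕ y) (toℕ z)) ⟩
        (toℕ x * (toℕ y * toℕ z)) mod m         ≡⟨ mod-* (toℕ x) (toℕ y * toℕ z) ⟩
        toℕ x mod m *ₘ ((toℕ y * toℕ z) mod m) ≡⟨ cong (_*ₘ (y *ₘ z)) (mod-toℕ x) ⟩
        x *ₘ (y *ₘ z)                           ∎

      distribˡ-ₘ : ∀ x y z → x *ₘ (y +ₘ z) ≡ (x *ₘ y) +ₘ (x *ₘ z)
      distribˡ-ₘ x y z = begin
        x *ₘ ((toℕ y + toℕ z) mod m) ≡⟨ cong (_*ₘ ((toℕ y + toℕ z) mod m)) (mod-toℕ x) ⟨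
        toℕ x mod m *ₘ ((toℕ y + toℕ z) mod m) ≡⟨ mod-* (toℕ x) (toℕ y + toℕ z) ⟨
        (toℕ x * (toℕ y + toℕ z)) mod m         ≡⟨ cong (_mod m) (*-distribˡ-+ (toℕ x) (toℕ y) (toℕ z)) ⟩
        (toℕ x * toℕ y + toℕ x * toℕ z) mod m   ≡⟨ mod-+ (toℕ x * toℕ y) (toℕ x * toℕ z) ⟩
        (x *ₘ y) +ₘ (x *ₘ z)                    ∎

      +-identityˡ-ₘ : ∀ x → 0ₘ +ₘ x ≡ x
      +-identityˡ-ₘ x = begin
        (toℕ (0 mod m) + toℕ x) mod m   ≡⟨ cong (λ z → (z + toℕ x) mod m) (toℕ-mod 0) ⟩
        (0 % m + toℕ x) mod m           ≡⟨ cong (λ z → (z + toℕ x) mod m) (m<n⇒m%n≡m (>-nonZero⁻¹ m)) ⟩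
        toℕ x mod m                     ≡⟨ mod-toℕ x ⟩
        x                               ∎

      *-identityˡ-ₘ : ∀ x → 1ₘ *ₘ x ≡ x
      *-identityˡ-ₘ x = begin
        1 mod m *ₘ x             ≡⟨ cong (1 mod m *ₘ_) (mod-toℕ x) ⟨
        1 mod m *ₘ (toℕ x mod m) ≡⟨ mod-* 1 (toℕ x) ⟨
        (1 * toℕ x) mod m        ≡⟨ cong (_mod m) (*-identityˡ (toℕ x)) ⟩
        toℕ x mod m              ≡⟨ mod-toℕ x ⟩
        x                        ∎

      -‿inverseˡ-ₘ : ∀ x → (-ₘ x) +ₘ x ≡ 0ₘ
      -‿inverseˡ-ₘ x = begin
        (m ∸ toℕ x) mod m +ₘ x             ≡⟨ cong ((m ∸ toℕ x) mod m +ₘ_) (mod-toℕ x) ⟨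
        (m ∸ toℕ x) mod m +ₘ toℕ x mod m   ≡⟨ mod-+ (m ∸ toℕ x) (toℕ x) ⟨
        (m ∸ toℕ x + toℕ x) mod m          ≡⟨ cong (_mod m) (m∸n+n≡m (<⇒≤ (toℕ<n x))) ⟩
        m mod m                            ≡⟨ mod-self ⟩
        0ₘ                                 ∎

      +-comm-ₘ : ∀ x y → x +ₘ y ≡ y +ₘ x
      +-comm-ₘ x y = cong (_mod m) (+-comm (toℕ x) (toℕ y))

      *-comm-ₘ : ∀ x y → x *ₘ y ≡ y *ₘ x
      *-comm-ₘ x y = cong (_mod m) (*-comm (toℕ x) (toℕ y))

    ℤ/m-isCommutativeRing : IsCommutativeRing _≡_ _+ₘ_ _*ₘ_ -ₘ_ 0ₘ 1ₘ
    ℤ/m-isCommutativeRing = record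
      { isRing = record
        { +-isAbelianGroup = record
          { isGroup = record
            { isMonoid = record
              { isSemigroup = record
                { isMagma = record { isEquivalence = isEquivalence ; ∙-cong = cong₂ _+ₘ_ }
                ; assoc = +-assoc-ₘ }
              ; identity = +-identityˡ-ₘ , λ x → trans (+-comm-ₘ x 0ₘ) (+-identityˡ-ₘ x) }
            ; inverse = -‿inverseˡ-ₘ , λ x → trans (+-comm-ₘ x (-ₘ x)) (-‿inverseˡ-ₘ x)
            ; ⁻¹-cong = cong -ₘ_ }
          ; comm = +-comm-ₘ }
        ; *-cong = cong₂ _*ₘ_
        ; *-assoc = *-assoc-ₘ
        ; *-identity = *-identityˡ-ₘ , λ x → trans (*-comm-ₘ x 1ₘ) (*-identityˡ-ₘ x)
        ; distrib = distribˡ-ₘ , λ x y z → trans (*-comm-ₘ (y +ₘ z) x)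
                                            (trans (distribˡ-ₘ x y z) (cong₂ _+ₘ_ (*-comm-ₘ x y) (*-comm-ₘ x z))) }
      ; *-comm = *-comm-ₘ }

    ℤ/m : CommutativeRing 0ℓ 0ℓ
    ℤ/m = record { isCommutativeRing = ℤ/m-isCommutativeRing }

module IntegerCoefficients (R : CommutativeRing 0ℓ 0ℓ) where

  -- The ring solver computes with its coefficients, which it cannot do in ℤ/p for a variable p;
  -- so the coefficients are integers, interpreted in R through the ring morphism ℤ → R.

  open import Data.Nat using (ℕ; zero; suc)
  import Data.Nat as ℕ
  open import Data.Nat.Properties using (+-suc)
  open import Data.Integer using (ℤ; +_; -[1+_]; _⊖_; _◃_; sign; ∣_∣; +-*-rawRing; _≟_)
  import Data.Integer as ℤ
  open import Data.Integer.Properties using ([1+m]⊖[1+n]≡m⊖n)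
  open import Data.Sign using (Sign)
  import Data.Sign as Sign
  open import Data.Maybe using (Maybe; just; nothing)
  open import Relation.Nullary using (yes; no)
  import Relation.Binary.PropositionalEquality as ≡
  open import Algebra.Solver.Ring.AlmostCommutativeRing
    using (fromCommutativeRing; _-Raw-AlmostCommutative⟶_)

  open CommutativeRing R
  open import Algebra.Properties.Ring ring using (-0#≈0#; -‿involutive; -‿distribˡ-*; -‿distribʳ-*; -‿+-comm)
  open import Algebra.Properties.Semiring.Mult.TCOptimised semiring using (_×_; ×1-homo-*; ×-homo-+)
  open import Relation.Binary.Reasoning.Setoid setoid

  private
    signed : Sign → Carrier → Carrier
    signed Sign.+ x = x
    signed Sign.- x = - x

    signed-cong : ∀ s {x y} → x ≈ y → signed s x ≈ signed s y
    signed-cong Sign.+ eq = eq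
    signed-cong Sign.- eq = -‿cong eq

    signed-* : ∀ s r x y → signed (s Sign.* r) (x * y) ≈ signed s x * signed r y
    signed-* Sign.+ Sign.+ x y = refl
    signed-* Sign.+ Sign.- x y = -‿distribʳ-* x y
    signed-* Sign.- Sign.+ x y = -‿distribˡ-* x y
    signed-* Sign.- Sign.- x y = begin
      x * y          ≈⟨ -‿involutive (x * y) ⟨
      - (- (x * y))  ≈⟨ -‿cong (-‿distribˡ-* x y) ⟩
      - (- x * y)    ≈⟨ -‿distribʳ-* (- x) y ⟩
      - x * - y      ∎

  ⟦_⟧ : ℤ → Carrier
  ⟦ + n ⟧      = n × 1#
  ⟦ -[1+ n ] ⟧ = - (suc n × 1#)

  private
    ⟦⟧-signed : ∀ i → ⟦ i ⟧ ≈ signed (sign i) (∣ i ∣ × 1#)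
    ⟦⟧-signed (+ n)      = refl
    ⟦⟧-signed -[1+ n ]   = refl

    ⟦⟧-◃ : ∀ s n → ⟦ s ◃ n ⟧ ≈ signed s (n × 1#)
    ⟦⟧-◃ Sign.+ zero    = refl
    ⟦⟧-◃ Sign.- zero    = sym -0#≈0#
    ⟦⟧-◃ Sign.+ (suc n) = refl
    ⟦⟧-◃ Sign.- (suc n) = refl

    ⟦⟧-⊖ : ∀ m n → ⟦ m ⊖ n ⟧ ≈ m × 1# - n × 1#
    ⟦⟧-⊖ m       zero    = sym (trans (+-congˡ -0#≈0#) (+-identityʳ _))
    ⟦⟧-⊖ zero    (suc n) = sym (+-identityˡ _)
    ⟦⟧-⊖ (suc m) (suc n) = begin
      ⟦ suc m ⊖ suc n ⟧                  ≡⟨ ≡.cong ⟦_⟧ ([1+m]⊖[1+n]≡m⊖n m n) ⟩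
      ⟦ m ⊖ n ⟧                          ≈⟨ ⟦⟧-⊖ m n ⟩
      m × 1# - n × 1#                    ≈⟨ +-identityˡ _ ⟨
      0# + (m × 1# - n × 1#)             ≈⟨ +-congʳ (-‿inverseʳ 1#) ⟨
      (1# - 1#) + (m × 1# - n × 1#)      ≈⟨ +-assoc 1# (- 1#) _ ⟩
      1# + (- 1# + (m × 1# - n × 1#))    ≈⟨ +-congˡ (+-assoc (- 1#) _ _) ⟨
      1# + ((- 1# + m × 1#) - n × 1#)    ≈⟨ +-congˡ (+-congʳ (+-comm (- 1#) _)) ⟩
      1# + ((m × 1# - 1#) - n × 1#)      ≈⟨ +-congˡ (+-assoc _ (- 1#) _) ⟩
      1# + (m × 1# + (- 1# - n × 1#))    ≈⟨ +-assoc 1# _ _ ⟨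
      (1# + m × 1#) + (- 1# - n × 1#)    ≈⟨ +-congˡ (-‿+-comm 1# (n × 1#)) ⟩
      (1# + m × 1#) - (1# + n × 1#)      ≈⟨ +-cong (×-homo-+ 1# 1 m) (-‿cong (×-homo-+ 1# 1 n)) ⟨
      suc m × 1# - suc n × 1#            ∎

  ⟦⟧-+ : ∀ i j → ⟦ i ℤ.+ j ⟧ ≈ ⟦ i ⟧ + ⟦ j ⟧
  ⟦⟧-+ (+ m)    (+ n)    = ×-homo-+ 1# m n
  ⟦⟧-+ (+ m)    -[1+ n ] = ⟦⟧-⊖ m (suc n)
  ⟦⟧-+ -[1+ m ] (+ n)    = trans (⟦⟧-⊖ n (suc m)) (+-comm _ _)
  ⟦⟧-+ -[1+ m ] -[1+ n ] = begin
    - (suc (suc (m ℕ.+ n)) × 1#)        ≡⟨ ≡.cong (λ k → - (suc k × 1#)) (+-suc m n) ⟨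
    - ((suc m ℕ.+ suc n) × 1#)          ≈⟨ -‿cong (×-homo-+ 1# (suc m) (suc n)) ⟩
    - (suc m × 1# + suc n × 1#)         ≈⟨ -‿+-comm _ _ ⟨
    - (suc m × 1#) + - (suc n × 1#)     ∎

  ⟦⟧-* : ∀ i j → ⟦ i ℤ.* j ⟧ ≈ ⟦ i ⟧ * ⟦ j ⟧
  ⟦⟧-* i j = begin
    ⟦ sign i Sign.* sign j ◃ ∣ i ∣ ℕ.* ∣ j ∣ ⟧                ≈⟨ ⟦⟧-◃ (sign i Sign.* sign j) (∣ i ∣ ℕ.* ∣ j ∣) ⟩
    signed (sign i Sign.* sign j) ((∣ i ∣ ℕ.* ∣ j ∣) × 1#)     ≈⟨ signed-cong (sign i Sign.* sign j) (×1-homo-* ∣ i ∣ ∣ j ∣) ⟩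
    signed (sign i Sign.* sign j) (∣ i ∣ × 1# * ∣ j ∣ × 1#)    ≈⟨ signed-* (sign i) (sign j) _ _ ⟩
    signed (sign i) (∣ i ∣ × 1#) * signed (sign j) (∣ j ∣ × 1#) ≈⟨ *-cong (⟦⟧-signed i) (⟦⟧-signed j) ⟨
    ⟦ i ⟧ * ⟦ j ⟧                                              ∎

  ⟦⟧-neg : ∀ i → ⟦ ℤ.- i ⟧ ≈ - ⟦ i ⟧
  ⟦⟧-neg (+ zero)  = sym -0#≈0#
  ⟦⟧-neg (+ suc n) = refl
  ⟦⟧-neg -[1+ n ]  = sym (-‿involutive _)

  ⟦⟧-homomorphism : +-*-rawRing -Raw-AlmostCommutative⟶ fromCommutativeRing R
  ⟦⟧-homomorphism = record
    { ⟦_⟧ = ⟦_⟧ ; +-homo = ⟦⟧-+ ; *-homo = ⟦⟧-* ; -‿homo = ⟦⟧-neg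
    ; 0-homo = refl ; 1-homo = refl }

  private
    ⟦⟧-≟ : ∀ i j → Maybe (⟦ i ⟧ ≈ ⟦ j ⟧)
    ⟦⟧-≟ i j with i ≟ j
    ... | yes ≡.refl = just refl
    ... | no _       = nothing

  open import Algebra.Solver.Ring +-*-rawRing (fromCommutativeRing R) ⟦⟧-homomorphism ⟦⟧-≟ public
    hiding (⟦_⟧)

  :0 :1 : ∀ {n} → Polynomial n
  :0 = con (+ 0)
  :1 = con (+ 1)

module PrimeField (p : ℕ) (p-prime : Prime p) where

  open import Data.Nat using (ℕ; NonZero; _<_; _%_; nonTrivial⇒n>1; >-nonZero⁻¹; ≢-nonZero)
  import Data.Nat as ℕ
  open import Data.Nat.DivMod using (_mod_; m<n⇒m%n≡m)
  open import Data.Nat.Divisibility using (_∣_; m%n≡0⇒n∣m; n∣m⇒m%n≡0)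
  open import Data.Nat.Primality using (Prime; prime⇒nonZero; prime⇒nonTrivial; euclidsLemma)
  open import Data.Nat.Coprimality using (prime⇒coprime; coprime-Bézout)
  open import Data.Nat.GCD using (module Bézout)
  open import Data.Fin using (toℕ)
  open import Data.Fin.Properties using (toℕ-injective; toℕ<n)
  open import Data.Product using (∃; _,_)
  open import Data.Sum using (_⊎_; inj₁; inj₂; map)
  open import Relation.Nullary using (contradiction)
  open import Function using (id)
  open import Relation.Binary.PropositionalEquality
  open import Algebra.Bundles using (CommutativeRing)
  open import Defs
  open IntegersModulo

  instance
    p-nonZero : NonZero p
    p-nonZero = prime⇒nonZero p-prime

  open CommutativeRing (ℤ/m p) using (_+_; _*_; -_; _-_; 0#; 1#; *-comm; +-identityʳ; zeroʳ; -‿inverseʳ; ring)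
  open import Algebra.Properties.Ring ring using (x[y-z]≈xy-xz; x∙y⁻¹≈ε⇒x≈y; x≈y⇒x∙y⁻¹≈ε; +-inverseˡ-unique)
  open IntegerCoefficients (ℤ/m p) using (solve; _:=_; _:+_; _:*_; _:-_; :-_; :0; :1)
  open ≡-Reasoning

  private
    p>1 : 1 < p
    p>1 = nonTrivial⇒n>1 p {{prime⇒nonTrivial p-prime}}

    toℕ-0# : toℕ 0# ≡ 0
    toℕ-0# = trans (toℕ-mod p 0) (m<n⇒m%n≡m (>-nonZero⁻¹ p))

    divisible⇒0# : ∀ x → p ∣ toℕ x → x ≡ 0#
    divisible⇒0# x p∣x = toℕ-injective (begin
      toℕ x      ≡⟨ m<n⇒m%n≡m (toℕ<n x) ⟨
      toℕ x % p  ≡⟨ n∣m⇒m%n≡0 (toℕ x) p p∣x ⟩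
      0          ≡⟨ toℕ-0# ⟨
      toℕ 0#     ∎)

    multiple⇒0# : ∀ a → (a ℕ.* p) mod p ≡ 0#
    multiple⇒0# a = begin
      (a ℕ.* p) mod p      ≡⟨ mod-* p a p ⟩
      a mod p * (p mod p) ≡⟨ cong (a mod p *_) (mod-self p) ⟩
      a mod p * 0#         ≡⟨ zeroʳ (a mod p) ⟩
      0#                   ∎

    -- b x ≡ (b · toℕ x) mod p, which is how an identity of naturals enters ℤ/p
    mod-*toℕ : ∀ b x → (b ℕ.* toℕ x) mod p ≡ b mod p * x
    mod-*toℕ b x = trans (mod-* p b (toℕ x)) (cong (b mod p *_) (mod-toℕ p x))

  1#≢0# : 1# ≢ 0#
  1#≢0# 1≡0 = 1≢0 (begin
    1            ≡⟨ m<n⇒m%n≡m p>1 ⟨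
    1 % p        ≡⟨ toℕ-mod p 1 ⟨
    toℕ 1#       ≡⟨ cong toℕ 1≡0 ⟩
    toℕ 0#       ≡⟨ toℕ-0# ⟩
    0            ∎)
    where
    1≢0 : 1 ≢ 0
    1≢0 ()

  no-zero-divisors : ∀ {x y} → x * y ≡ 0# → x ≡ 0# ⊎ y ≡ 0#
  no-zero-divisors {x} {y} xy≡0 =
    map (divisible⇒0# x) (divisible⇒0# y) (euclidsLemma (toℕ x) (toℕ y) p-prime p∣xy)
    where
    p∣xy : p ∣ toℕ x ℕ.* toℕ y
    p∣xy = m%n≡0⇒n∣m _ p (trans (sym (toℕ-mod p _)) (trans (cong toℕ xy≡0) toℕ-0#))

  inverse : ∀ {x} → x ≢ 0# → ∃ λ y → x * y ≡ 1#
  inverse {x} x≢0 with coprime-Bézout (prime⇒coprime p-prime {{x-nonZero}} (toℕ<n x))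
    where
    x-nonZero : NonZero (toℕ x)
    x-nonZero = ≢-nonZero λ x≡0 → x≢0 (toℕ-injective (trans x≡0 (sym toℕ-0#)))
  ... | Bézout.-+ a b 1+ap≡bx = b mod p , (begin
    x * (b mod p)             ≡⟨ *-comm x (b mod p) ⟩
    b mod p * x               ≡⟨ mod-*toℕ b x ⟨
    (b ℕ.* toℕ x) mod p       ≡⟨ cong (_mod p) 1+ap≡bx ⟨
    (1 ℕ.+ a ℕ.* p) mod p     ≡⟨ mod-+ p 1 (a ℕ.* p) ⟩
    1# + (a ℕ.* p) mod p      ≡⟨ cong (1# +_) (multiple⇒0# a) ⟩
    1# + 0#                   ≡⟨ +-identityʳ 1# ⟩
    1#                        ∎)
  ... | Bézout.+- a b 1+bx≡ap = - (b mod p) , (begin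
    x * - (b mod p)           ≡⟨ negate (b mod p) x ⟩
    1# - (1# + b mod p * x)   ≡⟨ cong (λ z → 1# - (1# + z)) (mod-*toℕ b x) ⟨
    1# - (1# + (b ℕ.* toℕ x) mod p) ≡⟨ cong (λ z → 1# - z) (mod-+ p 1 (b ℕ.* toℕ x)) ⟨
    1# - (1 ℕ.+ b ℕ.* toℕ x) mod p  ≡⟨ cong (λ n → 1# - n mod p) 1+bx≡ap ⟩
    1# - (a ℕ.* p) mod p      ≡⟨ cong (λ z → 1# - z) (multiple⇒0# a) ⟩
    1# - 0#                   ≡⟨ minus-zero 1# ⟩
    1#                        ∎)
    where
    negate : ∀ y x → x * - y ≡ 1# - (1# + y * x)
    negate = solve 2 (λ y x → x :* (:- y) := :1 :- (:1 :+ y :* x)) refl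
    minus-zero : ∀ x → x - 0# ≡ x
    minus-zero = solve 1 (λ x → x :- :0 := x) refl

  *-cancelˡ : ∀ {x y z} → x ≢ 0# → x * y ≡ x * z → y ≡ z
  *-cancelˡ {x} {y} {z} x≢0 xy≡xz with no-zero-divisors (trans (x[y-z]≈xy-xz x y z) (x≈y⇒x∙y⁻¹≈ε xy≡xz))
  ... | inj₁ x≡0   = contradiction x≡0 x≢0
  ... | inj₂ y-z≡0 = x∙y⁻¹≈ε⇒x≈y y z y-z≡0

  square≡1 : ∀ {x} → x * x ≡ 1# → x ≡ 1# ⊎ x ≡ - 1#
  square≡1 {x} xx≡1 =
    map (x∙y⁻¹≈ε⇒x≈y x 1#) (+-inverseˡ-unique x 1#)
        (no-zero-divisors (trans (difference-of-squares x) (x≈y⇒x∙y⁻¹≈ε xx≡1)))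
    where
    difference-of-squares : ∀ x → (x - 1#) * (x + 1#) ≡ x * x - 1#
    difference-of-squares = solve 1 (λ x → (x :- :1) :* (x :+ :1) := x :* x :- :1) refl

  square≡self : ∀ {x} → x * x ≡ x → x ≡ 0# ⊎ x ≡ 1#
  square≡self {x} xx≡x =
    map id (x∙y⁻¹≈ε⇒x≈y x 1#) (no-zero-divisors (trans (factor x) (x≈y⇒x∙y⁻¹≈ε xx≡x)))
    where
    factor : ∀ x → x * (x - 1#) ≡ x * x - x
    factor = solve 1 (λ x → x :* (x :- :1) := x :* x :- x) refl

  module _ (p>2 : 2 < p) where

    1#+1#≢0# : 1# + 1# ≢ 0#
    1#+1#≢0# 2≡0 = 2≢0 (begin
      2                 ≡⟨ m<n⇒m%n≡m p>2 ⟨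
      2 % p             ≡⟨ toℕ-mod p 2 ⟨
      toℕ (2 mod p)     ≡⟨ cong toℕ (mod-+ p 1 1) ⟩
      toℕ (1# + 1#)     ≡⟨ cong toℕ 2≡0 ⟩
      toℕ 0#            ≡⟨ toℕ-0# ⟩
      0                 ∎)
      where
      2≢0 : 2 ≢ 0
      2≢0 ()

    1#≢-1# : 1# ≢ - 1#
    1#≢-1# 1≡-1 = 1#+1#≢0# (trans (cong (1# +_) 1≡-1) (-‿inverseʳ 1#))

module RingIdempotents {c ℓ} (R : Ring c ℓ) where

  open import Data.Product using (_×_; _,_; proj₂)
  open Ring R
  open import Algebra.Properties.Ring R 
    using (x[y-z]≈xy-xz; [y-z]x≈yx-zx; -‿involutive; -‿distribʳ-*; -‿+-comm; -0#≈0#; +-inverseʳ-unique)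
  open import Algebra.Properties.Monoid *-monoid using (cancelˡ)
  open import Relation.Binary.Reasoning.Setoid setoid

  IsIdempotent : Carrier → Set ℓ
  IsIdempotent e = e * e ≈ e

  Orthogonal : Carrier → Carrier → Set ℓ
  Orthogonal e f = e * f ≈ 0# × f * e ≈ 0#

  inverse-unique : ∀ {u v w} → u * v ≈ 1# → w * u ≈ 1# → v ≈ w
  inverse-unique {u} {v} {w} uv≈1 wu≈1 = begin
    v            ≈⟨ cancelˡ wu≈1 v ⟨
    w * (u * v)  ≈⟨ *-congˡ uv≈1 ⟩
    w * 1#       ≈⟨ *-identityʳ w ⟩
    w            ∎

  x-0≈x : ∀ x → x - 0# ≈ x
  x-0≈x x = trans (+-congˡ -0#≈0#) (+-identityʳ x)

  1-[1-x]≈x : ∀ x → 1# - (1# - x) ≈ x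
  1-[1-x]≈x x = begin
    1# - (1# - x)        ≈⟨ +-congˡ (-‿+-comm 1# (- x)) ⟨
    1# + (- 1# + - - x)  ≈⟨ +-assoc 1# (- 1#) (- - x) ⟨
    (1# - 1#) + - - x    ≈⟨ +-cong (-‿inverseʳ 1#) (-‿involutive x) ⟩
    0# + x               ≈⟨ +-identityˡ x ⟩
    x                    ∎

  x+y≈1⇒y≈1-x : ∀ {x y} → x + y ≈ 1# → y ≈ 1# - x
  x+y≈1⇒y≈1-x {x} {y} x+y≈1 = begin
    y               ≈⟨ +-identityˡ y ⟨
    0# + y          ≈⟨ +-congʳ (-‿inverseˡ x) ⟨
    (- x + x) + y   ≈⟨ +-assoc (- x) x y ⟩
    - x + (x + y)   ≈⟨ +-congˡ x+y≈1 ⟩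
    - x + 1#        ≈⟨ +-comm (- x) 1# ⟩
    1# - x          ∎

  module _ {e} (idem : IsIdempotent e) where

    idempotent-complement-orthogonal : Orthogonal e (1# - e)
    idempotent-complement-orthogonal = left , right
      where
      left : e * (1# - e) ≈ 0#
      left = begin
        e * (1# - e)       ≈⟨ x[y-z]≈xy-xz e 1# e ⟩
        e * 1# - e * e     ≈⟨ +-cong (*-identityʳ e) (-‿cong idem) ⟩
        e - e              ≈⟨ -‿inverseʳ e ⟩
        0#                 ∎
      right : (1# - e) * e ≈ 0#
      right = begin
        (1# - e) * e       ≈⟨ [y-z]x≈yx-zx e 1# e ⟩
        1# * e - e * e     ≈⟨ +-cong (*-identityˡ e) (-‿cong idem) ⟩
        e - e              ≈⟨ -‿inverseʳ e ⟩
        0#                 ∎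

    idempotent-complement : IsIdempotent (1# - e)
    idempotent-complement = begin
      (1# - e) * (1# - e)           ≈⟨ x[y-z]≈xy-xz (1# - e) 1# e ⟩
      (1# - e) * 1# - (1# - e) * e  ≈⟨ +-cong (*-identityʳ (1# - e)) (-‿cong (proj₂ idempotent-complement-orthogonal)) ⟩
      (1# - e) - 0#                 ≈⟨ x-0≈x (1# - e) ⟩
      1# - e                        ∎

    orthogonal-sum-idempotent : ∀ {f} → IsIdempotent f → Orthogonal e f → IsIdempotent (e + f)
    orthogonal-sum-idempotent {f} idem-f (ef≈0 , fe≈0) = begin
      (e + f) * (e + f)              ≈⟨ distribʳ (e + f) e f ⟩
      e * (e + f) + f * (e + f)      ≈⟨ +-cong (distribˡ e e f) (distribˡ f e f) ⟩
      (e * e + e * f) + (f * e + f * f) ≈⟨ +-cong (+-cong idem ef≈0) (+-cong fe≈0 idem-f) ⟩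
      (e + 0#) + (0# + f)            ≈⟨ +-cong (+-identityʳ e) (+-identityˡ f) ⟩
      e + f                          ∎

    orthogonal-sum≈0 : ∀ {f} → Orthogonal e f → e + f ≈ 0# → e ≈ 0#
    orthogonal-sum≈0 {f} (ef≈0 , _) e+f≈0 = begin
      e            ≈⟨ -‿involutive e ⟨
      - (- e)      ≈⟨ -‿cong (-‿cong idem) ⟨
      - (- (e * e)) ≈⟨ -‿cong (-‿distribʳ-* e e) ⟩
      - (e * - e)  ≈⟨ -‿cong (*-congˡ (+-inverseʳ-unique e f e+f≈0)) ⟨
      - (e * f)    ≈⟨ -‿cong ef≈0 ⟩
      - 0#         ≈⟨ -0#≈0# ⟩
      0#           ∎

module MatrixRing (m : ℕ) .{{_ : NonZero m}} where

  open import Level using (0ℓ)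
  open import Data.Nat using (ℕ; NonZero)
  open import Data.Product using (_,_)
  open import Algebra.Bundles using (CommutativeRing; Ring)
  open import Algebra.Structures using (IsRing)
  open import Relation.Binary.PropositionalEquality
  open import Defs
  open IntegersModulo

  open Zmod m
  open CommutativeRing (ℤ/m m)
    using (_+_; _*_; -_; 0#; 1#; +-assoc; +-comm; +-identityˡ; +-identityʳ; -‿inverseˡ; -‿inverseʳ)
  open IntegerCoefficients (ℤ/m m) using (solve; _:=_; _:+_; _:*_; :-_; :0; :1)

  infixl 6 _⊕_

  _⊕_ : Mat → Mat → Mat
  mat a b c d ⊕ mat a′ b′ c′ d′ = mat (a + a′) (b + b′) (c + c′) (d + d′)

  ⊖_ : Mat → Mat
  ⊖ mat a b c d = mat (- a) (- b) (- c) (- d)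

  mat-≡ : ∀ {a b c d a′ b′ c′ d′} → a ≡ a′ → b ≡ b′ → c ≡ c′ → d ≡ d′ → mat a b c d ≡ mat a′ b′ c′ d′
  mat-≡ refl refl refl refl = refl

  private
    assoc-entry : ∀ x₁ x₂ y₁ y₂ y₃ y₄ z₁ z₂ →
      (x₁ * y₁ + x₂ * y₃) * z₁ + (x₁ * y₂ + x₂ * y₄) * z₂ ≡ x₁ * (y₁ * z₁ + y₂ * z₂) + x₂ * (y₃ * z₁ + y₄ * z₂)
    assoc-entry = solve 8 (λ x₁ x₂ y₁ y₂ y₃ y₄ z₁ z₂ →
      (x₁ :* y₁ :+ x₂ :* y₃) :* z₁ :+ (x₁ :* y₂ :+ x₂ :* y₄) :* z₂
        := x₁ :* (y₁ :* z₁ :+ y₂ :* z₂) :+ x₂ :* (y₃ :* z₁ :+ y₄ :* z₂)) refl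

    distribˡ-entry : ∀ x₁ x₂ y₁ y₂ z₁ z₂ → x₁ * (y₁ + z₁) + x₂ * (y₂ + z₂) ≡ (x₁ * y₁ + x₂ * y₂) + (x₁ * z₁ + x₂ * z₂)
    distribˡ-entry = solve 6 (λ x₁ x₂ y₁ y₂ z₁ z₂ →
      x₁ :* (y₁ :+ z₁) :+ x₂ :* (y₂ :+ z₂) := (x₁ :* y₁ :+ x₂ :* y₂) :+ (x₁ :* z₁ :+ x₂ :* z₂)) refl

    distribʳ-entry : ∀ x₁ x₂ y₁ y₂ z₁ z₂ → (y₁ + z₁) * x₁ + (y₂ + z₂) * x₂ ≡ (y₁ * x₁ + y₂ * x₂) + (z₁ * x₁ + z₂ * x₂)
    distribʳ-entry = solve 6 (λ x₁ x₂ y₁ y₂ z₁ z₂ →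
      (y₁ :+ z₁) :* x₁ :+ (y₂ :+ z₂) :* x₂ := (y₁ :* x₁ :+ y₂ :* x₂) :+ (z₁ :* x₁ :+ z₂ :* x₂)) refl

    unit-entry₁ : ∀ x y → 1# * x + 0# * y ≡ x
    unit-entry₁ = solve 2 (λ x y → :1 :* x :+ :0 :* y := x) refl

    unit-entry₂ : ∀ x y → 0# * x + 1# * y ≡ y
    unit-entry₂ = solve 2 (λ x y → :0 :* x :+ :1 :* y := y) refl

    unit-entry₃ : ∀ x y → x * 1# + y * 0# ≡ x
    unit-entry₃ = solve 2 (λ x y → x :* :1 :+ y :* :0 := x) refl

    unit-entry₄ : ∀ x y → x * 0# + y * 1# ≡ y
    unit-entry₄ = solve 2 (λ x y → x :* :0 :+ y :* :1 := y) refl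

  ·-assoc : ∀ x y z → (x · y) · z ≡ x · (y · z)
  ·-assoc (mat a b c d) (mat a′ b′ c′ d′) (mat a″ b″ c″ d″) =
    mat-≡ (assoc-entry a b a′ b′ c′ d′ a″ c″) (assoc-entry a b a′ b′ c′ d′ b″ d″)
          (assoc-entry c d a′ b′ c′ d′ a″ c″) (assoc-entry c d a′ b′ c′ d′ b″ d″)

  ·-identityˡ : ∀ x → I · x ≡ x
  ·-identityˡ (mat a b c d) = mat-≡ (unit-entry₁ a c) (unit-entry₁ b d) (unit-entry₂ a c) (unit-entry₂ b d)

  ·-identityʳ : ∀ x → x · I ≡ x
  ·-identityʳ (mat a b c d) = mat-≡ (unit-entry₃ a b) (unit-entry₄ a b) (unit-entry₃ c d) (unit-entry₄ c d)

  M₂-isRing : IsRing _≡_ _⊕_ _·_ ⊖_ O I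
  M₂-isRing = record
    { +-isAbelianGroup = record
      { isGroup = record
        { isMonoid = record
          { isSemigroup = record
            { isMagma = record { isEquivalence = isEquivalence ; ∙-cong = cong₂ _⊕_ }
            ; assoc = λ { (mat a b c d) (mat a′ b′ c′ d′) (mat a″ b″ c″ d″) →
                mat-≡ (+-assoc a a′ a″) (+-assoc b b′ b″) (+-assoc c c′ c″) (+-assoc d d′ d″) } }
          ; identity = (λ { (mat a b c d) → mat-≡ (+-identityˡ a) (+-identityˡ b) (+-identityˡ c) (+-identityˡ d) })
                     , (λ { (mat a b c d) → mat-≡ (+-identityʳ a) (+-identityʳ b) (+-identityʳ c) (+-identityʳ d) }) }
        ; inverse = (λ { (mat a b c d) → mat-≡ (-‿inverseˡ a) (-‿inverseˡ b) (-‿inverseˡ c) (-‿inverseˡ d) })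
                  , (λ { (mat a b c d) → mat-≡ (-‿inverseʳ a) (-‿inverseʳ b) (-‿inverseʳ c) (-‿inverseʳ d) })
        ; ⁻¹-cong = cong ⊖_ }
      ; comm = λ { (mat a b c d) (mat a′ b′ c′ d′) → mat-≡ (+-comm a a′) (+-comm b b′) (+-comm c c′) (+-comm d d′) } }
    ; *-cong = cong₂ _·_
    ; *-assoc = ·-assoc
    ; *-identity = ·-identityˡ , ·-identityʳ
    ; distrib = (λ { (mat a b c d) (mat a′ b′ c′ d′) (mat a″ b″ c″ d″) →
                   mat-≡ (distribˡ-entry a b a′ c′ a″ c″) (distribˡ-entry a b b′ d′ b″ d″)
                         (distribˡ-entry c d a′ c′ a″ c″) (distribˡ-entry c d b′ d′ b″ d″) })
              , (λ { (mat a b c d) (mat a′ b′ c′ d′) (mat a″ b″ c″ d″) →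
                   mat-≡ (distribʳ-entry a c a′ b′ a″ b″) (distribʳ-entry b d a′ b′ a″ b″)
                         (distribʳ-entry a c c′ d′ c″ d″) (distribʳ-entry b d c′ d′ c″ d″) }) }

  M₂ : Ring 0ℓ 0ℓ
  M₂ = record { isRing = M₂-isRing }

  scalar-square : ∀ l → mat l 0# 0# l · mat l 0# 0# l ≡ mat (l * l) 0# 0# (l * l)
  scalar-square l = mat-≡ (diagonal l) (off-diagonal l) (off-diagonal′ l) (diagonal′ l)
    where
    diagonal : ∀ l → l * l + 0# * 0# ≡ l * l
    diagonal = solve 1 (λ l → l :* l :+ :0 :* :0 := l :* l) refl
    off-diagonal : ∀ l → l * 0# + 0# * l ≡ 0#
    off-diagonal = solve 1 (λ l → l :* :0 :+ :0 :* l := :0) refl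
    off-diagonal′ : ∀ l → 0# * l + l * 0# ≡ 0#
    off-diagonal′ = solve 1 (λ l → :0 :* l :+ l :* :0 := :0) refl
    diagonal′ : ∀ l → 0# * 0# + l * l ≡ l * l
    diagonal′ = solve 1 (λ l → :0 :* :0 :+ l :* l := l :* l) refl

  -- Cayley–Hamilton for a trace-zero matrix: its square is - det times I
  trace-zero-square : ∀ a b c → mat a b c (- a) · mat a b c (- a) ≡ mat (a * a + b * c) 0# 0# (a * a + b * c)
  trace-zero-square a b c = mat-≡ refl (entry-b a b) (entry-c a c) (entry-d a b c)
    where
    entry-b : ∀ a b → a * b + b * - a ≡ 0#
    entry-b = solve 2 (λ a b → a :* b :+ b :* (:- a) := :0) refl
    entry-c : ∀ a c → c * a + - a * c ≡ 0#
    entry-c = solve 2 (λ a c → c :* a :+ (:- a) :* c := :0) refl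
    entry-d : ∀ a b c → c * b + - a * - a ≡ a * a + b * c
    entry-d = solve 3 (λ a b c → c :* b :+ (:- a) :* (:- a) := a :* a :+ b :* c) refl

  tr : Mat → Zm
  tr (mat a b c d) = a + d

  tr-⊕ : ∀ x y → tr (x ⊕ y) ≡ tr x + tr y
  tr-⊕ (mat a b c d) (mat a′ b′ c′ d′) = regroup a a′ d d′
    where
    regroup : ∀ a a′ d d′ → (a + a′) + (d + d′) ≡ (a + d) + (a′ + d′)
    regroup = solve 4 (λ a a′ d d′ → (a :+ a′) :+ (d :+ d′) := (a :+ d) :+ (a′ :+ d′)) refl

  square-b : ∀ x → Mat.b (x · x) ≡ Mat.b x * tr x
  square-b (mat a b c d) = solve 3 (λ a b d → a :* b :+ b :* d := b :* (a :+ d)) refl a b d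

  square-c : ∀ x → Mat.c (x · x) ≡ Mat.c x * tr x
  square-c (mat a b c d) = solve 3 (λ a c d → c :* a :+ d :* c := c :* (a :+ d)) refl a c d

  square-a : ∀ {x} → Mat.c x ≡ 0# → Mat.a (x · x) ≡ Mat.a x * Mat.a x
  square-a {mat a b c d} refl = solve 2 (λ a b → a :* a :+ b :* :0 := a :* a) refl a b

  square-d : ∀ {x} → Mat.b x ≡ 0# → Mat.d (x · x) ≡ Mat.d x * Mat.d x
  square-d {mat a b c d} refl = solve 2 (λ c d → c :* :0 :+ d :* d := d :* d) refl c d

module Quadrics (p : ℕ) (p-prime : Prime p) where

  open import Data.Nat using (_∸_) renaming (_+_ to _+ℕ_; _*_ to _*ℕ_)
  open import Data.Fin using (_≟_)
  open import Data.Product using (_×_; _,_; proj₁; proj₂)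
  open import Data.Sum using (_⊎_; inj₁; inj₂)
  open import Relation.Nullary using (Dec; yes; no; contradiction)
  open import Relation.Nullary.Decidable using (True; False; toWitness; fromWitness; toWitnessFalse; fromWitnessFalse)
  open import Relation.Binary.PropositionalEquality
  open import Function using (mk↔ₛ′)
  open import Function.Properties.Inverse using (↔-refl; ↔-trans)
  open import Algebra.Bundles using (CommutativeRing)
  open import Defs
  open FiniteCounting
  open IntegersModulo

  open PrimeField p p-prime
  open Zmod p
  open CommutativeRing (ℤ/m p) using (_+_; _*_; 0#; 1#; zeroˡ; *-identityʳ)
  open IntegerCoefficients (ℤ/m p) using (solve; _:=_; _:*_)
  open ≡-Reasoning

  Nonzero : Set
  Nonzero = Unsat (_≟ 0#)

  size-Nonzero : Nonzero HasSize (p ∸ 1)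
  size-Nonzero = size-Unsat (_≟ 0#) ↔-refl (size-Sat-one (_≟ 0#) refl (λ _ x≡0 → x≡0))

  Roots : (Zm → Zm) → Set
  Roots g = Sat (λ a → g a ≟ 0#)

  Quadric : (Zm → Zm) → Set
  Quadric g = Sat {A = Zm × Zm × Zm} (λ (a , b , c) → g a ≟ b * c)

  -- a point (a , b , c) with b ≠ 0 is fixed by (a , b); with b = 0 the point is (root , 0 , anything)
  size-Quadric : ∀ g {z} → Roots g HasSize z → Quadric g HasSize (p *ℕ (p ∸ 1) +ℕ z *ℕ p)
  size-Quadric g {z} roots = ↔-trans (mk↔ₛ′ forth back forth∘back back∘forth)
                                     (size-⊎ (size-× ↔-refl size-Nonzero) (size-× roots ↔-refl))
    where
    forth′ : ∀ a b c → g a ≡ b * c → Dec (b ≡ 0#) → (Zm × Nonzero) ⊎ (Roots g × Zm)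
    forth′ a b c eq (yes b≡0) = inj₂ ((a , fromWitness (trans eq (trans (cong (_* c) b≡0) (zeroˡ c)))) , c)
    forth′ a b c eq (no b≢0)  = inj₁ (a , (b , fromWitnessFalse b≢0))

    forth : Quadric g → (Zm × Nonzero) ⊎ (Roots g × Zm)
    forth ((a , b , c) , eq) = forth′ a b c (toWitness eq) (b ≟ 0#)

    quotient : ∀ {b} a (b≢0 : b ≢ 0#) → g a ≡ b * (g a * proj₁ (inverse b≢0))
    quotient {b} a b≢0 = begin
      g a                  ≡⟨ *-identityʳ (g a) ⟨
      g a * 1#             ≡⟨ cong (g a *_) (proj₂ (inverse b≢0)) ⟨
      g a * (b * b⁻¹)      ≡⟨ swap-left (g a) b b⁻¹ ⟩
      b * (g a * b⁻¹)      ∎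
      where
      b⁻¹ = proj₁ (inverse b≢0)
      swap-left : ∀ x y z → x * (y * z) ≡ y * (x * z)
      swap-left = solve 3 (λ x y z → x :* (y :* z) := y :* (x :* z)) refl

    back : (Zm × Nonzero) ⊎ (Roots g × Zm) → Quadric g
    back (inj₁ (a , (b , b≢0))) = (a , b , g a * proj₁ (inverse (toWitnessFalse b≢0))) , fromWitness (quotient a (toWitnessFalse b≢0))
    back (inj₂ ((a , root) , c)) = (a , 0# , c) , fromWitness (trans (toWitness root) (sym (zeroˡ c)))

    forth′-nonzero : ∀ a b c eq d (nz : False (b ≟ 0#)) → forth′ a b c eq d ≡ inj₁ (a , (b , nz))
    forth′-nonzero a b c eq (yes b≡0) nz = contradiction b≡0 (toWitnessFalse nz)
    forth′-nonzero a b c eq (no _)    nz = cong inj₁ (cong (a ,_) (Unsat≡ (_≟ 0#) refl))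

    forth′-zero : ∀ a c eq d (root : True (g a ≟ 0#)) → forth′ a 0# c eq d ≡ inj₂ ((a , root) , c)
    forth′-zero a c eq (yes _)   root = cong (λ r → inj₂ (r , c)) (Sat≡ (λ a → g a ≟ 0#) refl)
    forth′-zero a c eq (no 0≢0) root = contradiction refl 0≢0

    forth∘back : ∀ y → forth (back y) ≡ y
    forth∘back (inj₁ (a , (b , nz)))  = forth′-nonzero a b _ _ (b ≟ 0#) nz
    forth∘back (inj₂ ((a , root) , c)) = forth′-zero a c _ (0# ≟ 0#) root

    back∘forth′ : ∀ a b c (eq : True (g a ≟ b * c)) d → back (forth′ a b c (toWitness eq) d) ≡ ((a , b , c) , eq)
    back∘forth′ a b c eq (yes refl) = Sat≡ _ refl
    back∘forth′ a b c eq (no b≢0)   = Sat≡ _ (cong (λ c → a , b , c) (begin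
      g a * b⁻¹          ≡⟨ cong (_* b⁻¹) (toWitness eq) ⟩
      (b * c) * b⁻¹      ≡⟨ rotate b c b⁻¹ ⟩
      c * (b * b⁻¹)      ≡⟨ cong (c *_) (proj₂ (inverse b≢0)) ⟩
      c * 1#             ≡⟨ *-identityʳ c ⟩
      c                  ∎))
      where
      b⁻¹ = proj₁ (inverse b≢0)
      rotate : ∀ x y z → (x * y) * z ≡ y * (x * z)
      rotate = solve 3 (λ x y z → (x :* y) :* z := y :* (x :* z)) refl

    back∘forth : ∀ x → back (forth x) ≡ x
    back∘forth ((a , b , c) , eq) = back∘forth′ a b c eq (b ≟ 0#)

module SquareRootsOfI (p : ℕ) (p-prime : Prime p) where

  open import Data.Nat using (_∸_) renaming (_+_ to _+ℕ_; _*_ to _*ℕ_)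
  import Data.Nat as ℕ
  open import Data.Fin using (_≟_)
  open import Data.Product using (_×_; _,_; proj₁; proj₂)
  open import Data.Sum using (_⊎_; inj₁; inj₂; [_,_]′)
  open import Relation.Nullary using (¬?; Dec; yes; no; contradiction)
  open import Relation.Nullary.Decidable using (True; toWitness; fromWitness; _×-dec_)
  open import Relation.Binary.PropositionalEquality
  open import Function using (_↔_; mk↔ₛ′; id)
  open import Function.Properties.Inverse using (↔-trans)
  open import Algebra.Bundles using (CommutativeRing)
  open import Defs
  open FiniteCounting
  open IntegersModulo

  open PrimeField p p-prime
  open Zmod p
  open MatrixRing p using (mat-≡; scalar-square; trace-zero-square; tr; square-a; square-b; square-c; square-d)

  open Quadrics p p-prime using (Quadric; size-Quadric; Roots)
  open CommutativeRing (ℤ/m p) using (_+_; _*_; -_; _-_; 0#; 1#; ring; -‿inverseʳ)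
  open import Algebra.Properties.Ring ring using (x∙y⁻¹≈ε⇒x≈y; x≈y⇒x∙y⁻¹≈ε; +-inverseʳ-unique; -‿injective; -0#≈0#)
  open IntegerCoefficients (ℤ/m p) using (solve; _:=_; _:+_; _:*_; _:-_; :-_; :1)
  open ≡-Reasoning

  SquareRootOfI : Set
  SquareRootOfI = Sat (λ u → u · u ≟M I)

  ScalarRoot : Set
  ScalarRoot = Sat (λ l → (l * l ≟ 1#) ×-dec ¬? (l + l ≟ 0#))

  square-root-scalar : ∀ {u} → u · u ≡ I → tr u ≢ 0# → Mat.b u ≡ 0# × Mat.c u ≡ 0# × Mat.a u ≡ Mat.d u
  square-root-scalar {u@(mat a b c d)} uu≡I tr≢0 = b≡0 , c≡0 , a≡d
    where
    off-diagonal-vanishes : ∀ {z} → z * tr u ≡ 0# → z ≡ 0#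
    off-diagonal-vanishes ztr≡0 = [ id , (λ tr≡0 → contradiction tr≡0 tr≢0) ]′ (no-zero-divisors ztr≡0)
    b≡0 : b ≡ 0#
    b≡0 = off-diagonal-vanishes (trans (sym (square-b u)) (cong Mat.b uu≡I))
    c≡0 : c ≡ 0#
    c≡0 = off-diagonal-vanishes (trans (sym (square-c u)) (cong Mat.c uu≡I))
    a≡d : a ≡ d
    a≡d = [ x∙y⁻¹≈ε⇒x≈y a d , (λ tr≡0 → contradiction tr≡0 tr≢0) ]′ (no-zero-divisors {a - d} {a + d} (begin
      (a - d) * (a + d)    ≡⟨ difference-of-squares a d ⟩
      a * a - d * d        ≡⟨ cong₂ _-_ (trans (sym (square-a {u} c≡0)) (cong Mat.a uu≡I))
                                        (trans (sym (square-d {u} b≡0)) (cong Mat.d uu≡I)) ⟩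
      1# - 1#              ≡⟨ x≈y⇒x∙y⁻¹≈ε refl ⟩
      0#                   ∎))
      where
      difference-of-squares : ∀ a d → (a - d) * (a + d) ≡ a * a - d * d
      difference-of-squares = solve 2 (λ a d → (a :- d) :* (a :+ d) := a :* a :- d :* d) refl

  scalar-square-root : ∀ {l} → l * l ≡ 1# → mat l 0# 0# l · mat l 0# 0# l ≡ I
  scalar-square-root {l} ll≡1 = trans (scalar-square l) (cong (λ x → mat x 0# 0# x) ll≡1)

  trace-zero-square-root : ∀ {a b c} → 1# - a * a ≡ b * c → mat a b c (- a) · mat a b c (- a) ≡ I
  trace-zero-square-root {a} {b} {c} on-quadric =
    trans (trace-zero-square a b c) (cong (λ x → mat x 0# 0# x) aa+bc≡1)
    where
    aa+bc≡1 : a * a + b * c ≡ 1#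
    aa+bc≡1 = trans (cong (a * a +_) (sym on-quadric)) (complement (a * a))
      where
      complement : ∀ x → x + (1# - x) ≡ 1#
      complement = solve 1 (λ x → x :+ (:1 :- x) := :1) refl

  -- a square root of I either has nonzero trace, and is then ± I, or trace zero, and is then
  -- mat a b c (- a) with a² + bc = 1
  SquareRootOfI↔ : SquareRootOfI ↔ (ScalarRoot ⊎ Quadric (λ a → 1# - a * a))
  SquareRootOfI↔ = mk↔ₛ′ forth back forth∘back back∘forth
    where
    forth′ : ∀ u → u · u ≡ I → Dec (tr u ≡ 0#) → ScalarRoot ⊎ Quadric (λ a → 1# - a * a)
    forth′ u@(mat a b c d) uu≡I (yes tr≡0) =
      inj₂ ((a , b , c) , fromWitness (trans (cong (_- a * a) (sym (cong Mat.a uu≡I))) (cancel (a * a) (b * c))))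
      where
      cancel : ∀ x y → (x + y) - x ≡ y
      cancel = solve 2 (λ x y → (x :+ y) :- x := y) refl
    forth′ u@(mat a b c d) uu≡I (no tr≢0) =
      inj₁ (a , fromWitness (aa≡1 , λ a+a≡0 → tr≢0 (trans (cong (a +_) (sym a≡d)) a+a≡0)))
      where
      scalar = square-root-scalar {u} uu≡I tr≢0
      a≡d = proj₂ (proj₂ scalar)
      aa≡1 : a * a ≡ 1#
      aa≡1 = trans (sym (square-a {u} (proj₁ (proj₂ scalar)))) (cong Mat.a uu≡I)

    forth : SquareRootOfI → ScalarRoot ⊎ Quadric (λ a → 1# - a * a)
    forth (u , uu≡I) = forth′ u (toWitness uu≡I) (tr u ≟ 0#)

    back : ScalarRoot ⊎ Quadric (λ a → 1# - a * a) → SquareRootOfI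
    back (inj₁ (l , root))                 = mat l 0# 0# l , fromWitness (scalar-square-root (proj₁ (toWitness root)))
    back (inj₂ ((a , b , c) , on-quadric)) = mat a b c (- a) , fromWitness (trace-zero-square-root (toWitness on-quadric))

    forth′-scalar : ∀ l (root : True (_ ≟ _ ×-dec ¬? (l + l ≟ 0#))) uu≡I d →
                    forth′ (mat l 0# 0# l) uu≡I d ≡ inj₁ (l , root)
    forth′-scalar l root uu≡I (yes l+l≡0) = contradiction l+l≡0 (proj₂ (toWitness root))
    forth′-scalar l root uu≡I (no _)      = cong inj₁ (Sat≡ _ refl)

    forth′-trace-zero : ∀ a b c (on-quadric : True (1# - a * a ≟ b * c)) uu≡I d →
                        forth′ (mat a b c (- a)) uu≡I d ≡ inj₂ ((a , b , c) , on-quadric)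
    forth′-trace-zero a b c on-quadric uu≡I (yes _)    = cong inj₂ (Sat≡ _ refl)
    forth′-trace-zero a b c on-quadric uu≡I (no tr≢0) = contradiction (-‿inverseʳ a) tr≢0

    forth∘back : ∀ y → forth (back y) ≡ y
    forth∘back (inj₁ (l , root))                   = forth′-scalar l root _ (l + l ≟ 0#)
    forth∘back (inj₂ ((a , b , c) , on-quadric))  = forth′-trace-zero a b c on-quadric _ (a + - a ≟ 0#)

    back∘forth′ : ∀ u (uu≡I : True (u · u ≟M I)) d → back (forth′ u (toWitness uu≡I) d) ≡ (u , uu≡I)
    back∘forth′ (mat a b c d) uu≡I (yes tr≡0) = Sat≡ _ (cong (mat a b c) (sym (+-inverseʳ-unique a d tr≡0)))
    back∘forth′ u@(mat a b c d) uu≡I (no tr≢0) = Sat≡ _ (mat-≡ refl (sym b≡0) (sym c≡0) a≡d)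
      where
      scalar = square-root-scalar {u} (toWitness uu≡I) tr≢0
      b≡0 = proj₁ scalar
      c≡0 = proj₁ (proj₂ scalar)
      a≡d = proj₂ (proj₂ scalar)

    back∘forth : ∀ x → back (forth x) ≡ x
    back∘forth (u , uu≡I) = back∘forth′ u uu≡I (tr u ≟ 0#)

  size-SquareRootOfI : ∀ {s z} → ScalarRoot HasSize s → Roots (λ a → 1# - a * a) HasSize z →
                       SquareRootOfI HasSize (s +ℕ (p *ℕ (p ∸ 1) +ℕ z *ℕ p))
  size-SquareRootOfI scalars roots = ↔-trans SquareRootOfI↔ (size-⊎ scalars (size-Quadric _ roots))

  module _ (p>2 : 2 ℕ.< p) where

    private
      -1·-1≡1 : - 1# * - 1# ≡ 1#
      -1·-1≡1 = solve 0 (:- :1 :* :- :1 := :1) refl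

      1·1≡1 : 1# * 1# ≡ 1#
      1·1≡1 = solve 0 (:1 :* :1 := :1) refl

      -1+-1≡-[1+1] : - 1# + - 1# ≡ - (1# + 1#)
      -1+-1≡-[1+1] = solve 0 (:- :1 :+ :- :1 := :- (:1 :+ :1)) refl

      -1+-1≢0 : - 1# + - 1# ≢ 0#
      -1+-1≢0 -2≡0 = 1#+1#≢0# p>2 (-‿injective (trans (sym -1+-1≡-[1+1]) (trans -2≡0 (sym -0#≈0#))))

    size-ScalarRoot : ScalarRoot HasSize 2
    size-ScalarRoot = size-Sat-two _ _≟_ (1#≢-1# p>2) (1·1≡1 , 1#+1#≢0# p>2) (-1·-1≡1 , -1+-1≢0)
                                   (λ l (ll≡1 , _) → square≡1 ll≡1)

    size-roots : Roots (λ a → 1# - a * a) HasSize 2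
    size-roots = size-Sat-two _ _≟_ (1#≢-1# p>2) (x≈y⇒x∙y⁻¹≈ε (sym 1·1≡1)) (x≈y⇒x∙y⁻¹≈ε (sym -1·-1≡1))
                              (λ a 1-aa≡0 → square≡1 (sym (x∙y⁻¹≈ε⇒x≈y 1# (a * a) 1-aa≡0)))

module GeneralLinear (p : ℕ) (p-prime : Prime p) where

  open import Data.Nat using (_∸_) renaming (_+_ to _+ℕ_; _*_ to _*ℕ_)
  open import Data.Fin using (_≟_)
  open import Data.Fin.Properties using (any?)
  open import Data.Product.Properties using (≡-dec)
  open import Data.Bool.Properties using (T-irrelevant)
  open import Relation.Binary.Definitions using (DecidableEquality)
  open import Data.Product using (Σ; ∃; _×_; _,_; proj₁; proj₂; swap)
  open import Data.Sum using ([_,_]′)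
  open import Relation.Nullary using (¬_; Dec; yes; no; contradiction)
  open import Relation.Nullary.Decidable using (toWitness; fromWitness; toWitnessFalse; fromWitnessFalse; _×-dec_)
  open import Relation.Binary.PropositionalEquality
  open import Function using (_↔_; _⇔_; mk↔ₛ′; mk⇔; id; Equivalence)
  open import Function.Properties.Inverse using (↔-refl; ↔-trans; ↔-sym)
  open import Algebra.Bundles using (CommutativeRing)
  open import Defs
  open FiniteCounting
  open IntegersModulo
  open ShurikenIsomorphism using (Unit; Unit≡; MutuallyInverse)

  open PrimeField p p-prime
  open Zmod p
  open MatrixRing p using (mat-≡; M₂)
  open RingIdempotents M₂ using (inverse-unique)
  open SquareRootsOfI p p-prime using (SquareRootOfI)
  open CommutativeRing (ℤ/m p) using (_+_; _*_; -_; _-_; 0#; 1#; zeroʳ; *-identityʳ; *-comm; *-assoc; -‿inverseʳ)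
  open IntegerCoefficients (ℤ/m p) using (solve; _:=_; _:+_; _:*_; _:-_; :-_; :0; :1)
  open ≡-Reasoning

  Row : Set
  Row = Zm × Zm

  _≟Row_ : DecidableEquality Row
  _≟Row_ = ≡-dec _≟_ _≟_

  row₁ row₂ : Mat → Row
  row₁ (mat a b _ _) = a , b
  row₂ (mat _ _ c d) = c , d

  InSpan : Row → Row → Set
  InSpan (a , b) (c , d) = ∃ λ l → l * a ≡ c × l * b ≡ d

  InSpan? : ∀ r s → Dec (InSpan r s)
  InSpan? (a , b) (c , d) = any? λ l → (l * a ≟ c) ×-dec (l * b ≟ d)

  det : Mat → Zm
  det (mat a b c d) = a * d - b * c

  adjugate : Mat → Mat
  adjugate (mat a b c d) = mat d (- b) (- c) a

  _∙_ : Zm → Mat → Mat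
  l ∙ mat a b c d = mat (l * a) (l * b) (l * c) (l * d)

  ·-adjugate : ∀ u l → u · (l ∙ adjugate u) ≡ mat (l * det u) 0# 0# (l * det u)
  ·-adjugate (mat a b c d) l = mat-≡ (entry-a a b c d l) (entry-b a b l) (entry-c c d l) (entry-d a b c d l)
    where
    entry-a : ∀ a b c d l → a * (l * d) + b * (l * - c) ≡ l * (a * d - b * c)
    entry-a = solve 5 (λ a b c d l → a :* (l :* d) :+ b :* (l :* (:- c)) := l :* (a :* d :- b :* c)) refl
    entry-b : ∀ a b l → a * (l * - b) + b * (l * a) ≡ 0#
    entry-b = solve 3 (λ a b l → a :* (l :* (:- b)) :+ b :* (l :* a) := :0) refl
    entry-c : ∀ c d l → c * (l * d) + d * (l * - c) ≡ 0#
    entry-c = solve 3 (λ c d l → c :* (l :* d) :+ d :* (l :* (:- c)) := :0) refl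
    entry-d : ∀ a b c d l → c * (l * - b) + d * (l * a) ≡ l * (a * d - b * c)
    entry-d = solve 5 (λ a b c d l → c :* (l :* (:- b)) :+ d :* (l :* a) := l :* (a :* d :- b :* c)) refl

  adjugate-· : ∀ u l → (l ∙ adjugate u) · u ≡ mat (l * det u) 0# 0# (l * det u)
  adjugate-· (mat a b c d) l = mat-≡ (entry-a a b c d l) (entry-b b d l) (entry-c a c l) (entry-d a b c d l)
    where
    entry-a : ∀ a b c d l → (l * d) * a + (l * - b) * c ≡ l * (a * d - b * c)
    entry-a = solve 5 (λ a b c d l → (l :* d) :* a :+ (l :* (:- b)) :* c := l :* (a :* d :- b :* c)) refl
    entry-b : ∀ b d l → (l * d) * b + (l * - b) * d ≡ 0#
    entry-b = solve 3 (λ b d l → (l :* d) :* b :+ (l :* (:- b)) :* d := :0) refl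
    entry-c : ∀ a c l → (l * - c) * a + (l * a) * c ≡ 0#
    entry-c = solve 3 (λ a c l → (l :* (:- c)) :* a :+ (l :* a) :* c := :0) refl
    entry-d : ∀ a b c d l → (l * - c) * b + (l * a) * d ≡ l * (a * d - b * c)
    entry-d = solve 5 (λ a b c d l → (l :* (:- c)) :* b :+ (l :* a) :* d := l :* (a :* d :- b :* c)) refl

  det≢0⇒unit : ∀ u → det u ≢ 0# → IsUnit u
  det≢0⇒unit u det≢0 = l ∙ adjugate u , trans (·-adjugate u l) scalar≡I , trans (adjugate-· u l) scalar≡I
    where
    l = proj₁ (inverse det≢0)
    scalar≡I : mat (l * det u) 0# 0# (l * det u) ≡ I
    scalar≡I = cong (λ x → mat x 0# 0# x) (trans (*-comm l (det u)) (proj₂ (inverse det≢0)))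

  unit⇒row₁≢0 : ∀ {u v} → u · v ≡ I → row₁ u ≢ (0# , 0#)
  unit⇒row₁≢0 {mat a b c d} {mat a′ b′ c′ d′} uv≡I refl =
    1#≢0# (trans (sym (cong Mat.a uv≡I)) (vanishing a′ c′))
    where
    vanishing : ∀ x y → 0# * x + 0# * y ≡ 0#
    vanishing = solve 2 (λ x y → :0 :* x :+ :0 :* y := :0) refl

  unit⇒row₂∉span : ∀ {u v} → u · v ≡ I → ¬ InSpan (row₁ u) (row₂ u)
  unit⇒row₂∉span {mat a b c d} {mat a′ b′ c′ d′} uv≡I (l , refl , refl) = 1#≢0# (begin
    1#                              ≡⟨ cong Mat.d uv≡I ⟨
    (l * a) * b′ + (l * b) * d′     ≡⟨ factor l a b b′ d′ ⟩
    l * (a * b′ + b * d′)           ≡⟨ cong (l *_) (cong Mat.b uv≡I) ⟩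
    l * 0#                          ≡⟨ zeroʳ l ⟩
    0#                              ∎)
    where
    factor : ∀ l a b b′ d′ → (l * a) * b′ + (l * b) * d′ ≡ l * (a * b′ + b * d′)
    factor = solve 5 (λ l a b b′ d′ → (l :* a) :* b′ :+ (l :* b) :* d′ := l :* (a :* b′ :+ b :* d′)) refl

  det≡0⇒InSpan : ∀ u → det u ≡ 0# → row₁ u ≢ (0# , 0#) → InSpan (row₁ u) (row₂ u)
  det≡0⇒InSpan (mat a b c d) det≡0 row≢0 = by-cases (a ≟ 0#)
    where
    by-cases : Dec (a ≡ 0#) → InSpan (a , b) (c , d)
    by-cases (no a≢0) = c * a⁻¹ , (begin
        (c * a⁻¹) * a      ≡⟨ *-assoc c a⁻¹ a ⟩
        c * (a⁻¹ * a)      ≡⟨ cong (c *_) (trans (*-comm a⁻¹ a) (proj₂ (inverse a≢0))) ⟩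
        c * 1#             ≡⟨ *-identityʳ c ⟩
        c                  ∎) , (begin
        (c * a⁻¹) * b                      ≡⟨ expand a b c d a⁻¹ ⟩
        d * (a * a⁻¹) - a⁻¹ * det (mat a b c d) ≡⟨ cong₂ (λ x y → d * x - a⁻¹ * y) (proj₂ (inverse a≢0)) det≡0 ⟩
        d * 1# - a⁻¹ * 0#                  ≡⟨ simplify d a⁻¹ ⟩
        d                                  ∎)
      where
      a⁻¹ = proj₁ (inverse a≢0)
      expand : ∀ a b c d i → (c * i) * b ≡ d * (a * i) - i * (a * d - b * c)
      expand = solve 5 (λ a b c d i → (c :* i) :* b := d :* (a :* i) :- i :* (a :* d :- b :* c)) refl
      simplify : ∀ d i → d * 1# - i * 0# ≡ d
      simplify = solve 2 (λ d i → d :* :1 :- i :* :0 := d) refl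
    by-cases (yes refl) = d * b⁻¹ , trans (zeroʳ (d * b⁻¹)) (sym c≡0) , (begin
        (d * b⁻¹) * b      ≡⟨ *-assoc d b⁻¹ b ⟩
        d * (b⁻¹ * b)      ≡⟨ cong (d *_) (trans (*-comm b⁻¹ b) (proj₂ (inverse b≢0))) ⟩
        d * 1#             ≡⟨ *-identityʳ d ⟩
        d                  ∎)
      where
      b≢0 : b ≢ 0#
      b≢0 b≡0 = row≢0 (cong (0# ,_) b≡0)
      b⁻¹ = proj₁ (inverse b≢0)
      bc≡0 : b * c ≡ 0#
      bc≡0 = begin
        b * c                       ≡⟨ rearrange b c d ⟩
        0# - (0# * d - b * c)       ≡⟨ cong (λ x → 0# - x) det≡0 ⟩
        0# - 0#                     ≡⟨ -‿inverseʳ 0# ⟩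
        0#                          ∎
        where
        rearrange : ∀ b c d → b * c ≡ 0# - (0# * d - b * c)
        rearrange = solve 3 (λ b c d → b :* c := :0 :- (:0 :* d :- b :* c)) refl
      c≡0 : c ≡ 0#
      c≡0 = [ (λ b≡0 → contradiction b≡0 b≢0) , id ]′ (no-zero-divisors {b} {c} bc≡0)

  unit⇔rows : ∀ u → IsUnit u ⇔ (row₁ u ≢ (0# , 0#) × ¬ InSpan (row₁ u) (row₂ u))
  unit⇔rows u = mk⇔ (λ (v , uv≡I , _) → unit⇒row₁≢0 {u} {v} uv≡I , unit⇒row₂∉span {u} {v} uv≡I)
                    (λ (row≢0 , ∉span) → det≢0⇒unit u (λ det≡0 → ∉span (det≡0⇒InSpan u det≡0 row≢0)))

  NonzeroRow : Set
  NonzeroRow = Unsat (_≟Row (0# , 0#))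

  size-NonzeroRow : NonzeroRow HasSize (p *ℕ p ∸ 1)
  size-NonzeroRow = size-Unsat _ (size-× ↔-refl ↔-refl) (size-Sat-one _ refl (λ _ r≡0 → r≡0))

  size-span : ∀ r → r ≢ (0# , 0#) → Sat (InSpan? r) HasSize p
  size-span (a , b) r≢0 = ↔-sym (mk↔ₛ′ multiple coefficient multiple∘coefficient coefficient∘multiple)
    where
    multiple : Zm → Sat (InSpan? (a , b))
    multiple l = (l * a , l * b) , fromWitness (l , refl , refl)
    coefficient : Sat (InSpan? (a , b)) → Zm
    coefficient (_ , inSpan) = proj₁ (toWitness inSpan)
    multiple∘coefficient : ∀ y → multiple (coefficient y) ≡ y
    multiple∘coefficient (_ , inSpan) with toWitness inSpan
    ... | l , refl , refl = Sat≡ _ refl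
    cancel : ∀ {l m} → l * a ≡ m * a → l * b ≡ m * b → l ≡ m
    cancel {l} {m} la≡ma lb≡mb with a ≟ 0#
    ... | no a≢0    = *-cancelˡ a≢0 (trans (*-comm a l) (trans la≡ma (*-comm m a)))
    ... | yes refl  = *-cancelˡ (λ b≡0 → r≢0 (cong (0# ,_) b≡0)) (trans (*-comm b l) (trans lb≡mb (*-comm m b)))
    coefficient∘multiple : ∀ l → coefficient (multiple l) ≡ l
    coefficient∘multiple l with toWitness (proj₂ (multiple l))
    ... | m , ma≡la , mb≡lb = cancel ma≡la mb≡lb

  IndependentRows : Set
  IndependentRows = Σ NonzeroRow (λ r → Unsat (InSpan? (proj₁ r)))

  IndependentRows≡ : ∀ {x y : IndependentRows} →
    proj₁ (proj₁ x) ≡ proj₁ (proj₁ y) → proj₁ (proj₂ x) ≡ proj₁ (proj₂ y) → x ≡ y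
  IndependentRows≡ {(r , _) , (s , _)} refl refl = cong₂ (λ x y → (r , x) , (s , y)) (T-irrelevant _ _) (T-irrelevant _ _)

  Unit↔rows : Unit p ↔ IndependentRows
  Unit↔rows = mk↔ₛ′ rows matrix rows∘matrix matrix∘rows
    where
    rows : Unit p → IndependentRows
    rows (u , unit) = (row₁ u , fromWitnessFalse (proj₁ independent)) , (row₂ u , fromWitnessFalse (proj₂ independent))
      where independent = Equivalence.to (unit⇔rows u) (toWitness unit)
    matrix : IndependentRows → Unit p
    matrix (((a , b) , r≢0) , ((c , d) , ∉span)) =
      mat a b c d , fromWitness (Equivalence.from (unit⇔rows (mat a b c d)) (toWitnessFalse r≢0 , toWitnessFalse ∉span))
    rows∘matrix : ∀ y → rows (matrix y) ≡ y
    rows∘matrix _ = IndependentRows≡ refl refl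
    matrix∘rows : ∀ x → matrix (rows x) ≡ x
    matrix∘rows (mat a b c d , _) = Unit≡ p refl

  size-Unit : Unit p HasSize ((p *ℕ p ∸ 1) *ℕ (p *ℕ p ∸ p))
  size-Unit = ↔-trans Unit↔rows (size-Σ {B = λ r → Unsat (InSpan? (proj₁ r))} size-NonzeroRow λ (r , r≢0) →
    size-Unsat (InSpan? r) (size-× ↔-refl ↔-refl) (size-span r (toWitnessFalse r≢0)))

  infix 4 _≟U_
  infix 8 _⁻¹

  _≟U_ : DecidableEquality (Unit p)
  (u , _) ≟U (v , _) with u ≟M v
  ... | yes u≡v = yes (Unit≡ p u≡v)
  ... | no u≢v  = no (λ eq → u≢v (cong proj₁ eq))

  -- opaque, so that the search hidden in toWitness is never unfolded during type checking
  opaque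
    _⁻¹ : Unit p → Unit p
    (u , unit) ⁻¹ = proj₁ (toWitness unit) , fromWitness (u , swap (proj₂ (toWitness unit)))

    ⁻¹-inverse : ∀ x → MutuallyInverse p (proj₁ x) (proj₁ (x ⁻¹))
    ⁻¹-inverse (u , unit) = proj₂ (toWitness unit)

  inverse⇔⁻¹ : ∀ x y → MutuallyInverse p (proj₁ x) (proj₁ y) ⇔ (y ≡ x ⁻¹)
  inverse⇔⁻¹ x y = mk⇔ (λ (xy≡I , _) → Unit≡ p (inverse-unique xy≡I (proj₂ (⁻¹-inverse x))))
                       (λ { refl → ⁻¹-inverse x })

  ⁻¹-involutive : ∀ x → (x ⁻¹) ⁻¹ ≡ x
  ⁻¹-involutive x = Unit≡ p (inverse-unique (proj₁ (⁻¹-inverse (x ⁻¹))) (proj₁ (⁻¹-inverse x)))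

  self-inverse↔SquareRootOfI : Sat (λ x → x ⁻¹ ≟U x) ↔ SquareRootOfI
  self-inverse↔SquareRootOfI = mk↔ₛ′ forth back (λ _ → Sat≡ _ refl) (λ _ → Sat≡ _ (Unit≡ p refl))
    where
    forth : Sat (λ x → x ⁻¹ ≟U x) → SquareRootOfI
    forth (x , fixed) = proj₁ x , fromWitness (subst (λ y → proj₁ x · proj₁ y ≡ I) (toWitness fixed) (proj₁ (⁻¹-inverse x)))
    back : SquareRootOfI → Sat (λ x → x ⁻¹ ≟U x)
    back (u , uu≡I) = (u , unit) , fromWitness (sym (Equivalence.to (inverse⇔⁻¹ (u , unit) (u , unit)) (toWitness uu≡I , toWitness uu≡I)))
      where
      unit = fromWitness (u , toWitness uu≡I , toWitness uu≡I)

module Idempotents (p : ℕ) (p-prime : Prime p) where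

  open import Data.Nat using (_∸_) renaming (_+_ to _+ℕ_; _*_ to _*ℕ_)
  open import Data.Fin using (_≟_)
  open import Data.Product using (_×_; _,_; proj₁)
  open import Data.Sum using (_⊎_; inj₁; inj₂)
  open import Relation.Nullary using (Dec; yes; no; contradiction)
  open import Relation.Nullary.Decidable using (True; False; toWitness; fromWitness; toWitnessFalse; fromWitnessFalse)
  open import Function using (_↔_; _⇔_; mk↔ₛ′; mk⇔; Equivalence)
  open import Relation.Binary.Definitions using (DecidableEquality)
  open import Function.Properties.Inverse using (↔-trans)
  open import Relation.Binary.PropositionalEquality
  open import Algebra.Bundles using (CommutativeRing; Ring)
  open import Defs
  open IntegersModulo
  open FiniteCounting
  open ShurikenIsomorphism using (NonzeroIdempotent; NonzeroIdempotent≡)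

  open PrimeField p p-prime
  open Zmod p
  open CommutativeRing (ℤ/m p)
    using (_+_; _*_; -_; _-_; 0#; 1#; ring; +-identityʳ; +-identityˡ; *-identityʳ; -‿inverseʳ)
  open import Algebra.Properties.Ring ring using (x∙y⁻¹≈ε⇒x≈y; x[y-z]≈xy-xz; +-identityʳ-unique)
  open IntegerCoefficients (ℤ/m p) using (solve; _:=_; _:+_; _:*_; _:-_; :-_; :0; :1)
  open MatrixRing p
  open Quadrics p p-prime using (Quadric; Roots; size-Quadric)
  open RingIdempotents M₂
    using (Orthogonal; orthogonal-sum-idempotent; orthogonal-sum≈0; x+y≈1⇒y≈1-x; 1-[1-x]≈x;
           idempotent-complement; idempotent-complement-orthogonal)
  open Ring M₂ using () renaming (-‿inverseʳ to ⊕-inverseʳ)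
  open RingIdempotents ring using () renaming (x+y≈1⇒y≈1-x to x+y≡1⇒y≡1-x)
  open import Algebra.Properties.Ring M₂ using () renaming (x∙y⁻¹≈ε⇒x≈y to x⊕⊖y≡O⇒x≡y)
  open ≡-Reasoning

  idempotent-trichotomy : ∀ {e} → IsIdempotent e → e ≡ O ⊎ e ≡ I ⊎ tr e ≡ 1#
  idempotent-trichotomy {e@(mat a b c d)} idem with tr e ≟ 1#
  ... | yes tr≡1 = inj₂ (inj₂ tr≡1)
  ... | no tr≢1  = diagonal (square≡self a²≡a) (square≡self d²≡d)
    where
    vanish : ∀ {z} → z * tr e ≡ z → z ≡ 0#
    vanish {z} ztr≡z with no-zero-divisors (begin
      z * (tr e - 1#)     ≡⟨ x[y-z]≈xy-xz z (tr e) 1# ⟩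
      z * tr e - z * 1#   ≡⟨ cong₂ _-_ ztr≡z (*-identityʳ z) ⟩
      z - z               ≡⟨ -‿inverseʳ z ⟩
      0#                  ∎)
    ... | inj₁ z≡0    = z≡0
    ... | inj₂ tr-1≡0 = contradiction (x∙y⁻¹≈ε⇒x≈y (tr e) 1# tr-1≡0) tr≢1
    b≡0 : b ≡ 0#
    b≡0 = vanish (trans (sym (square-b e)) (cong Mat.b idem))
    c≡0 : c ≡ 0#
    c≡0 = vanish (trans (sym (square-c e)) (cong Mat.c idem))
    a²≡a : a * a ≡ a
    a²≡a = trans (sym (square-a {e} c≡0)) (cong Mat.a idem)
    d²≡d : d * d ≡ d
    d²≡d = trans (sym (square-d {e} b≡0)) (cong Mat.d idem)
    diagonal : a ≡ 0# ⊎ a ≡ 1# → d ≡ 0# ⊎ d ≡ 1# → e ≡ O ⊎ e ≡ I ⊎ tr e ≡ 1#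
    diagonal (inj₁ a≡0) (inj₁ d≡0) = inj₁ (mat-≡ a≡0 b≡0 c≡0 d≡0)
    diagonal (inj₂ a≡1) (inj₂ d≡1) = inj₂ (inj₁ (mat-≡ a≡1 b≡0 c≡0 d≡1))
    diagonal (inj₁ a≡0) (inj₂ d≡1) = contradiction (trans (cong₂ _+_ a≡0 d≡1) (+-identityˡ 1#)) tr≢1
    diagonal (inj₂ a≡1) (inj₁ d≡0) = contradiction (trans (cong₂ _+_ a≡1 d≡0) (+-identityʳ 1#)) tr≢1

  idempotent-trace : ∀ {e} → IsIdempotent e → e ≢ O → e ≢ I → tr e ≡ 1#
  idempotent-trace idem e≢O e≢I with idempotent-trichotomy idem
  ... | inj₁ e≡O        = contradiction e≡O e≢O
  ... | inj₂ (inj₁ e≡I) = contradiction e≡I e≢I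
  ... | inj₂ (inj₂ tr≡1) = tr≡1

  orthogonal-idempotents : ∀ {e f} → IsIdempotent e → IsIdempotent f → e ≢ O → f ≢ O →
                           Orthogonal e f → e ≢ I × f ≡ I ⊕ ⊖ e
  orthogonal-idempotents {e} {f} idem-e idem-f e≢O f≢O orth@(ef≡O , fe≡O) = e≢I , f≡I-e
    where
    e≢I : e ≢ I
    e≢I refl = f≢O (trans (sym (·-identityˡ f)) ef≡O)
    f≢I : f ≢ I
    f≢I refl = e≢O (trans (sym (·-identityʳ e)) ef≡O)
    f≡I-e : f ≡ I ⊕ ⊖ e
    f≡I-e = by-cases (idempotent-trichotomy {e ⊕ f} (orthogonal-sum-idempotent {e} idem-e {f} idem-f orth))
      where
      by-cases : e ⊕ f ≡ O ⊎ e ⊕ f ≡ I ⊎ tr (e ⊕ f) ≡ 1# → f ≡ I ⊕ ⊖ e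
      by-cases (inj₁ e+f≡O)        = contradiction (orthogonal-sum≈0 idem-e orth e+f≡O) e≢O
      by-cases (inj₂ (inj₁ e+f≡I)) = x+y≈1⇒y≈1-x e+f≡I
      by-cases (inj₂ (inj₂ tr≡1))  = contradiction (+-identityʳ-unique 1# 1# (begin
        1# + 1#          ≡⟨ cong₂ _+_ (idempotent-trace idem-e e≢O e≢I) (idempotent-trace idem-f f≢O f≢I) ⟨
        tr e + tr f      ≡⟨ tr-⊕ e f ⟨
        tr (e ⊕ f)       ≡⟨ tr≡1 ⟩
        1#               ∎)) 1#≢0#

  private
    E : Set
    E = NonzeroIdempotent p

    idempotent : (x : E) → IsIdempotent (proj₁ x)
    idempotent (_ , idem , _) = toWitness idem

    nonzero : (x : E) → proj₁ x ≢ O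
    nonzero (_ , _ , nz) = toWitnessFalse nz

  private
    partner′ : ∀ e (idem : True (e · e ≟M e)) (nz : False (e ≟M O)) → Dec (e ≡ I) → E
    partner′ e idem nz (yes _)  = e , idem , nz
    partner′ e idem nz (no e≢I) =
      I ⊕ ⊖ e , fromWitness (idempotent-complement (toWitness idem))
              , fromWitnessFalse (λ I-e≡O → e≢I (sym (x⊕⊖y≡O⇒x≡y I e I-e≡O)))

  -- the orthogonality partner of a nonzero idempotent e ≠ I is I - e; I is its own partner
  partner : E → E
  partner (e , idem , nz) = partner′ e idem nz (e ≟M I)

  PartnerView : E → Set
  PartnerView x = (proj₁ x ≡ I × partner x ≡ x) ⊎ (proj₁ x ≢ I × proj₁ (partner x) ≡ I ⊕ ⊖ proj₁ x)

  partner-view : ∀ x → PartnerView x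
  partner-view (e , idem , nz) = view (e ≟M I)
    where
    view : ∀ d → (e ≡ I × partner′ e idem nz d ≡ (e , idem , nz)) ⊎ (e ≢ I × proj₁ (partner′ e idem nz d) ≡ I ⊕ ⊖ e)
    view (yes e≡I) = inj₁ (e≡I , refl)
    view (no e≢I)  = inj₂ (e≢I , refl)

  partner-fixed⇔I : ∀ x → partner x ≡ x ⇔ proj₁ x ≡ I
  partner-fixed⇔I x = mk⇔ (fixed⇒I (partner-view x)) (I⇒fixed (partner-view x))
    where
    fixed⇒I : PartnerView x → partner x ≡ x → proj₁ x ≡ I
    fixed⇒I (inj₁ (x≡I , _)) _ = x≡I
    fixed⇒I (inj₂ (_ , partner≡I-x)) fixed = contradiction (begin
      proj₁ x                     ≡⟨ idempotent x ⟨
      proj₁ x · proj₁ x           ≡⟨ cong (proj₁ x ·_) (trans (sym (cong proj₁ fixed)) partner≡I-x) ⟩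
      proj₁ x · (I ⊕ ⊖ proj₁ x)   ≡⟨ proj₁ (idempotent-complement-orthogonal (idempotent x)) ⟩
      O                           ∎) (nonzero x)
    I⇒fixed : PartnerView x → proj₁ x ≡ I → partner x ≡ x
    I⇒fixed (inj₁ (_ , fixed)) _ = fixed
    I⇒fixed (inj₂ (x≢I , _)) x≡I = contradiction x≡I x≢I

  partner-involutive : ∀ x → partner (partner x) ≡ x
  partner-involutive x = by-views (partner-view x) (partner-view (partner x))
    where
    by-views : PartnerView x → PartnerView (partner x) → partner (partner x) ≡ x
    by-views (inj₁ (_ , fixed)) _ = trans (cong partner fixed) fixed
    by-views (inj₂ (x≢I , partner≡I-x)) (inj₁ (partner≡I , _)) = contradiction (begin
      proj₁ x               ≡⟨ 1-[1-x]≈x (proj₁ x) ⟨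
      I ⊕ ⊖ (I ⊕ ⊖ proj₁ x) ≡⟨ cong (λ y → I ⊕ ⊖ y) (trans (sym partner≡I-x) partner≡I) ⟩
      I ⊕ ⊖ I               ≡⟨ ⊕-inverseʳ I ⟩
      O                     ∎) (nonzero x)
    by-views (inj₂ (_ , partner≡I-x)) (inj₂ (_ , partner²≡)) = NonzeroIdempotent≡ p (begin
      proj₁ (partner (partner x))   ≡⟨ partner²≡ ⟩
      I ⊕ ⊖ proj₁ (partner x)       ≡⟨ cong (λ y → I ⊕ ⊖ y) partner≡I-x ⟩
      I ⊕ ⊖ (I ⊕ ⊖ proj₁ x)         ≡⟨ 1-[1-x]≈x (proj₁ x) ⟩
      proj₁ x                       ∎)

  orthogonal⇔partner : ∀ x y → Orthogonal (proj₁ x) (proj₁ y) ⇔ (partner x ≢ x × y ≡ partner x)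
  orthogonal⇔partner x y = mk⇔ (λ orth → forth (partner-view x) (orthogonal-idempotents
                                   (idempotent x) (idempotent y) (nonzero x) (nonzero y) orth))
                                (back (partner-view x))
    where
    forth : PartnerView x → proj₁ x ≢ I × proj₁ y ≡ I ⊕ ⊖ proj₁ x → partner x ≢ x × y ≡ partner x
    forth (inj₁ (x≡I , _)) (x≢I , _) = contradiction x≡I x≢I
    forth (inj₂ (_ , partner≡I-x)) (x≢I , y≡I-x) =
      (λ fixed → x≢I (Equivalence.to (partner-fixed⇔I x) fixed)) ,
      NonzeroIdempotent≡ p (trans y≡I-x (sym partner≡I-x))
    back : PartnerView x → partner x ≢ x × y ≡ partner x → Orthogonal (proj₁ x) (proj₁ y)
    back (inj₁ (_ , fixed)) (moved , _) = contradiction fixed moved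
    back (inj₂ (_ , partner≡I-x)) (_ , y≡partner) =
      subst (Orthogonal (proj₁ x)) (sym (trans (cong proj₁ y≡partner) partner≡I-x))
            (idempotent-complement-orthogonal (idempotent x))

  trace-one-idempotent : ∀ a b c → a - a * a ≡ b * c → IsIdempotent (mat a b c (1# - a))
  trace-one-idempotent a b c on-quadric = mat-≡
    (trans (cong (a * a +_) (sym on-quadric)) (entry-a a))
    (entry-b a b) (entry-c a c)
    (trans (commute a b c) (trans (cong (_+ (1# - a) * (1# - a)) (sym on-quadric)) (entry-d a)))
    where
    entry-a : ∀ a → a * a + (a - a * a) ≡ a
    entry-a = solve 1 (λ a → a :* a :+ (a :- a :* a) := a) refl
    entry-b : ∀ a b → a * b + b * (1# - a) ≡ b
    entry-b = solve 2 (λ a b → a :* b :+ b :* (:1 :- a) := b) refl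
    entry-c : ∀ a c → c * a + (1# - a) * c ≡ c
    entry-c = solve 2 (λ a c → c :* a :+ (:1 :- a) :* c := c) refl
    commute : ∀ a b c → c * b + (1# - a) * (1# - a) ≡ b * c + (1# - a) * (1# - a)
    commute = solve 3 (λ a b c → c :* b :+ (:1 :- a) :* (:1 :- a) := b :* c :+ (:1 :- a) :* (:1 :- a)) refl
    entry-d : ∀ a → (a - a * a) + (1# - a) * (1# - a) ≡ 1# - a
    entry-d = solve 1 (λ a → (a :- a :* a) :+ (:1 :- a) :* (:1 :- a) := :1 :- a) refl

  -- a nonzero idempotent other than I has trace one, so it is mat a b c (1 - a) with a - a² = bc
  NonzeroIdempotent≢I↔Quadric : Unsat (λ (x : E) → proj₁ x ≟M I) ↔ Quadric (λ a → a - a * a)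
  NonzeroIdempotent≢I↔Quadric = mk↔ₛ′ forth back (λ _ → Sat≡ _ refl) back∘forth
    where
    forth : Unsat (λ (x : E) → proj₁ x ≟M I) → Quadric (λ a → a - a * a)
    forth ((mat a b c d , idem , _) , _) =
      (a , b , c) , fromWitness (trans (cong (_- a * a) (sym (cong Mat.a (toWitness idem)))) (cancel (a * a) (b * c)))
      where
      cancel : ∀ x y → (x + y) - x ≡ y
      cancel = solve 2 (λ x y → (x :+ y) :- x := y) refl
    back : Quadric (λ a → a - a * a) → Unsat (λ (x : E) → proj₁ x ≟M I)
    back ((a , b , c) , on-quadric) =
      (mat a b c (1# - a) , fromWitness (trace-one-idempotent a b c (toWitness on-quadric)) , fromWitnessFalse ≢O)
      , fromWitnessFalse ≢I
      where
      ≢O : mat a b c (1# - a) ≢ O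
      ≢O eq = 1#≢0# (trans (x∙y⁻¹≈ε⇒x≈y 1# a (cong Mat.d eq)) (cong Mat.a eq))
      ≢I : mat a b c (1# - a) ≢ I
      ≢I eq = 1#≢0# (sym (trans (sym (-‿inverseʳ 1#)) (trans (cong (λ x → 1# - x) (sym (cong Mat.a eq))) (cong Mat.d eq))))
    back∘forth : ∀ x → back (forth x) ≡ x
    back∘forth ((mat a b c d , idem , nz) , ≢I) = Unsat≡ _ (NonzeroIdempotent≡ p (cong (mat a b c) (sym d≡1-a)))
      where
      d≡1-a : d ≡ 1# - a
      d≡1-a = x+y≡1⇒y≡1-x (idempotent-trace {mat a b c d} (toWitness idem) (toWitnessFalse nz) (toWitnessFalse ≢I))

  I-idempotent : E
  I-idempotent = I , fromWitness (·-identityˡ I) , fromWitnessFalse (λ I≡O → 1#≢0# (cong Mat.a I≡O))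

  size-NonzeroIdempotent : E HasSize (1 +ℕ (p *ℕ (p ∸ 1) +ℕ 2 *ℕ p))
  size-NonzeroIdempotent = ↔-trans (Sat⊎Unsat (λ (x : E) → proj₁ x ≟M I))
    (size-⊎ (size-Sat-one (λ (x : E) → proj₁ x ≟M I) {I-idempotent} refl (λ _ x≡I → NonzeroIdempotent≡ p x≡I))
            (↔-trans NonzeroIdempotent≢I↔Quadric (size-Quadric (λ a → a - a * a) roots)))
    where
    roots : Roots (λ a → a - a * a) HasSize 2
    roots = size-Sat-two (λ a → a - a * a ≟ 0#) _≟_ (λ 0≡1 → 1#≢0# (sym 0≡1)) zero-root one-root
                         (λ a root → square≡self (sym (x∙y⁻¹≈ε⇒x≈y a (a * a) root)))
      where
      zero-root : 0# - 0# * 0# ≡ 0#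
      zero-root = solve 0 (:0 :- :0 :* :0 := :0) refl
      one-root : 1# - 1# * 1# ≡ 0#
      one-root = solve 0 (:1 :- :1 :* :1 := :0) refl

  infix 4 _≟E_

  _≟E_ : DecidableEquality E
  (e , _) ≟E (f , _) with e ≟M f
  ... | yes e≡f = yes (NonzeroIdempotent≡ p e≡f)
  ... | no e≢f  = no (λ eq → e≢f (cong proj₁ eq))

  size-partner-fixed : Sat (λ x → partner x ≟E x) HasSize 1
  size-partner-fixed = size-Sat-one (λ x → partner x ≟E x) {I-idempotent} (Equivalence.from (partner-fixed⇔I I-idempotent) refl)
    (λ x fixed → NonzeroIdempotent≡ p (Equivalence.to (partner-fixed⇔I x) fixed))

module CleanGraph where

  open import Data.Nat using (ℕ; zero; suc; _+_; _*_; _∸_; _^_; _/_)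
  open import Data.Nat.Properties using (m+n∸m≡n; m+n∸n≡m; suc-injective)
  open import Data.Nat.DivMod using (m*n/n≡m)
  open import Data.Nat.Tactic.RingSolver using (solve-∀)
  open import Data.Nat.Primality using (Prime)
  open import Data.Product using (proj₁)
  open import Data.Fin using (Fin)
  open import Relation.Binary.PropositionalEquality
  open import Function using (_↔_; _⇔_; Equivalence)
  open import Function.Properties.Inverse using (↔-trans)
  open import Function.Properties.Equivalence using () renaming (trans to ⇔-trans)
  open import Defs
  open FiniteCounting
  open InvolutionOrbits
  open ShurikenLayout
  open ShurikenIsomorphism

  private
    units-count : ∀ p → (p * p ∸ 1) * (p * p ∸ p) ≡ (p ^ 4 + p) ∸ (p ^ 3 + p ^ 2)
    units-count zero    = refl
    units-count (suc q) = begin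
      (q + q * suc q) * (suc (q + q * suc q) ∸ suc q)          ≡⟨ cong ((q + q * suc q) *_) (m+n∸m≡n q (q * suc q)) ⟩
      (q + q * suc q) * (q * suc q)                             ≡⟨ m+n∸n≡m _ (suc q ^ 3 + suc q ^ 2) ⟨
      ((q + q * suc q) * (q * suc q) + (suc q ^ 3 + suc q ^ 2)) ∸ (suc q ^ 3 + suc q ^ 2)
                                                                ≡⟨ cong (_∸ (suc q ^ 3 + suc q ^ 2)) (expand q) ⟩
      (suc q ^ 4 + suc q) ∸ (suc q ^ 3 + suc q ^ 2)             ∎
      where
      open ≡-Reasoning
      -- the powers are spelled out as the products they unfold to
      expand : ∀ q → (q + q * suc q) * (q * suc q) + (suc q * (suc q * (suc q * 1)) + suc q * (suc q * 1))
                     ≡ suc q * (suc q * (suc q * (suc q * 1))) + suc q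
      expand = solve-∀

    idempotents-count : ∀ p → p * (p ∸ 1) + 2 * p ≡ p * (p + 1)
    idempotents-count zero    = refl
    idempotents-count (suc q) = expand q
      where
      expand : ∀ q → suc q * q + 2 * suc q ≡ suc q * (suc q + 1)
      expand = solve-∀

    half-of-double : ∀ {k n} → k + k ≡ n → k ≡ n / 2
    half-of-double {k} refl = sym (trans (cong (_/ 2) (k+k≡k*2 k)) (m*n/n≡m k 2))
      where
      k+k≡k*2 : ∀ k → k + k ≡ k * 2
      k+k≡k*2 = solve-∀

  square-roots-count : ∀ p → 2 + (p * (p ∸ 1) + 2 * p) ≡ p ^ 2 + p + 2
  square-roots-count zero    = refl
  square-roots-count (suc q) = expand q
    where
    expand : ∀ q → 2 + (suc q * q + 2 * suc q) ≡ suc q * (suc q * 1) + suc q + 2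
    expand = solve-∀

  module _ (p : ℕ) (p-prime : Prime p) where

    open PrimeField p p-prime using (p-nonZero)
    open Idempotents p p-prime
      using (partner; partner-involutive; _≟E_; size-partner-fixed; size-NonzeroIdempotent; orthogonal⇔partner)
    open GeneralLinear p p-prime
      using (_⁻¹; ⁻¹-involutive; _≟U_; size-Unit; inverse⇔⁻¹; self-inverse↔SquareRootOfI)
    open SquareRootsOfI p p-prime using (SquareRootOfI)

    private
      E-conjugacy : FlipConjugacy _≟E_ partner partner-involutive 1
      E-conjugacy = flipConjugacy _≟E_ partner partner-involutive size-NonzeroIdempotent size-partner-fixed

    open FlipConjugacy E-conjugacy using () renaming (pairs to kE; conj to conjE; moved-partner⇔ to moved-partner⇔E)

    φ : NonzeroIdempotent p ↔ Vertex (kE K₂ ⁺)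
    φ = ↔-trans conjE orbits↔K₂⁺

    φ-orthogonal : ∀ x y → Orthogonal p (proj₁ x) (proj₁ y) ⇔ _~_ (kE K₂ ⁺) (to φ x) (to φ y)
    φ-orthogonal x y = ⇔-trans (orthogonal⇔partner x y)
      (⇔-trans (moved-partner⇔E x y) (flip-partner⇔K₂⁺ (to conjE x) (to conjE y)))

    kE≡ : kE ≡ (p * (p + 1)) / 2
    kE≡ = half-of-double (trans (sym (suc-injective sizes)) (idempotents-count p))
      where
      sizes : 1 + (p * (p ∸ 1) + 2 * p) ≡ 1 + (kE + kE)
      sizes = size-unique size-NonzeroIdempotent (↔-trans conjE (size-Orbits 1 kE))

    module _ {t : ℕ} (roots : SquareRootOfI HasSize t) where

      private
        U-conjugacy : FlipConjugacy _≟U_ _⁻¹ ⁻¹-involutive t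
        U-conjugacy = flipConjugacy _≟U_ _⁻¹ ⁻¹-involutive size-Unit (↔-trans self-inverse↔SquareRootOfI roots)

      open FlipConjugacy U-conjugacy using () renaming (pairs to kU; conj to conjU; σ⇔flip to σ⇔flipU)

      ψ : Unit p ↔ Fin (t + (kU + kU))
      ψ = ↔-trans conjU (layout t kU)

      ψ-inverse : ∀ u v → MutuallyInverse p (proj₁ u) (proj₁ v) ⇔ ShuLink t (to ψ u) (to ψ v)
      ψ-inverse u v = ⇔-trans (inverse⇔⁻¹ u v)
        (⇔-trans (σ⇔flipU u v) (flip⇔ShuLink t kU (to conjU u) (to conjU v)))

      n≡ : t + (kU + kU) ≡ (p ^ 4 + p) ∸ (p ^ 3 + p ^ 2)
      n≡ = trans (sym (size-unique size-Unit (↔-trans conjU (size-Orbits t kU)))) (units-count p)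

      Cl₂M₂ℤ≅Shuriken : Cl₂M₂ℤ p p-prime ≅ Shu t ((p ^ 4 + p) ∸ (p ^ 3 + p ^ 2)) (((p * (p + 1)) / 2) K₂)
      Cl₂M₂ℤ≅Shuriken = subst₂ (λ n a → Cl₂M₂ℤ p p-prime ≅ Shu t n (a K₂)) n≡ kE≡ (Cl₂M₂≅Shu p φ φ-orthogonal ψ ψ-inverse)

open import Defs
open import Data.Nat using (ℕ; _+_; _*_; _∸_; _^_; _<_; _/_)
open import Data.Nat.Primality using (Prime)
open import Data.Product using (_×_; _,_; proj₂)
open import Relation.Binary.PropositionalEquality using (_≡_; refl; subst)
open import Function.Properties.Inverse using (↔-refl)
open FiniteCounting using (size-Sat)
open SquareRootsOfI using (size-SquareRootOfI; size-ScalarRoot; size-roots)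
open CleanGraph using (Cl₂M₂ℤ≅Shuriken; square-roots-count)

mainTheorem9 : (p : ℕ) → (pp : Prime p) →
    (p ≡ 2 → Cl₂M₂ℤ p pp ≅ Shu 4 6 (3 K₂))
    × (2 < p → Cl₂M₂ℤ p pp ≅ Shu (p ^ 2 + p + 2) ((p ^ 4 + p) ∸ (p ^ 3 + p ^ 2)) (((p * (p + 1)) / 2) K₂))
mainTheorem9 p pp = characteristic-two , odd-characteristic
  where
  -- over ℤ/2 there is no scalar square root of I off the trace-zero locus and 1 is the only root of 1 - a²:
  -- both counts are computed by evaluation
  characteristic-two : p ≡ 2 → Cl₂M₂ℤ p pp ≅ Shu 4 6 (3 K₂)
  characteristic-two refl = Cl₂M₂ℤ≅Shuriken 2 pp
    (size-SquareRootOfI 2 pp (proj₂ (size-Sat _ ↔-refl)) (proj₂ (size-Sat _ ↔-refl)))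
  odd-characteristic : 2 < p → Cl₂M₂ℤ p pp ≅ Shu (p ^ 2 + p + 2) ((p ^ 4 + p) ∸ (p ^ 3 + p ^ 2)) (((p * (p + 1)) / 2) K₂)
  odd-characteristic p>2 = subst (λ t → Cl₂M₂ℤ p pp ≅ Shu t ((p ^ 4 + p) ∸ (p ^ 3 + p ^ 2)) (((p * (p + 1)) / 2) K₂))
    (square-roots-count p)
    (Cl₂M₂ℤ≅Shuriken p pp (size-SquareRootOfI p pp (size-ScalarRoot p pp p>2) (size-roots p pp p>2)))
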